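{- Let $i\to i'\to\mathcal{L}\leftarrow j'\leftarrow j$ and $n\to n'\to\mathcal{G}\leftarrow k'\leftarrow k$ be MDA extended cospans of e-hypergraphs over $\Sigma$ and let $m:\mathcal{L}\to\mathcal{G}$ be a mono in $\mathbf{EHyp}(\Sigma)$. If a boundary complement $i+j\to\mathcal{L}^{\bot}\to\mathcal{G}$ exists, it is unique.
   Context: E-hypergraph over a monoidal signature $\Sigma$: $(V,E,s,t,l,<,\smile)$ with finite $V,E$, $s,t:E\to V^*$, $l:E\to\Sigma+\{\bot\}$ respecting arities, $<$ a strict partial order on $V+E$ ($x'<x$: $x'$ is a predecessor of $x$; $e<^\mu x$: immediate predecessor); $\bot$-labelled edges are hierarchical; elements without predecessors are top-level; conditions: predecessors are hierarchical edges, at most one immediate predecessor, edges without successors are not labelled $\bot$, and if $v\in s(e)\cup t(e)$ then $e'<^\mu e$ iff $e'<^\mu v$. $\smile$ is a union of equivalence relations $\smile_p$ on the sets of immediate children of hierarchical $p$, closed under connectivity and not total. Homomorphisms preserve $s,t,l$, immediate predecessors, and $\smile$; category $\mathbf{EHyp}(\Sigma)$. An extended cospan $n\to n'\to\mathcal{G}\leftarrow k'\leftarrow k$ has discrete linearly ordered $n,n',k,k'$, mono outer maps, top-level external interface images and non-top-level strictly internal interface vertices ($n'\setminus n$, $k'\setminus k$). It is MDA if the underlying hypergraph is acyclic, the internal legs are mono, all vertices have in- and out-degree $\le1$, and in-degree-$0$ (out-degree-$0$) vertices are exactly the image of the input (output) internal leg; a hierarchical edge $e$ is well-typed if each $\smile$-block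 of its strictly internal input (output) children has $|s(e)|$ ($|t(e)|$) elements. Boundary complement: a pushout complement $i+j\xrightarrow{[c_1,c_2]}\mathcal{L}^{\bot}\xrightarrow{g}\mathcal{G}$ (so that $\mathcal{G}$ is the pushout of $\mathcal{L}\leftarrow i+j\to\mathcal{L}^\bot$ with $\mathcal{L}\to\mathcal{G}$ equal to $m$) such that: (1) $m(\mathcal{L})$ is convex (contains every path between its vertices) and down-closed (contains all children of its edges); (2) $[c_1,c_2]$ is mono; (3) all vertices of $\mathcal{G}$ in the image of $i+j$ share the same set of predecessors and are either top-level or pairwise $\smile$; (4) the same holds in $\mathcal{L}^\bot$; (5) there are $d_1:n\to\mathcal{L}^\bot$, $d_2:k\to\mathcal{L}^\bot$ with $d_1;g$ and $d_2;g$ equal to the external interface maps of $\mathcal{G}$; (6) if $m$ maps the external interfaces of $\mathcal{L}$ to top-level vertices, then $n+j\to n'\setminus(i'\setminus i)+j\xrightarrow{[g_1,c_2]}\mathcal{L}^\bot\xleftarrow{[g_2,c_1]}k'\setminus(j'\setminus j)+i\leftarrow k+i$ is a well-typed MDA extended cospan; (7) if $m$ maps them to non-top-level vertices, then $n\to n'\setminus(i'\setminus i)+j\to\mathcal{L}^\bot\leftarrow k'\setminus(j'\setminus j)+i\leftarrow k$ is an MDA extended cospan (not necessarily well-typed). Here $i'\setminus i$ is identified inside $n'$ via $m$, and $g_1,g_2$ (and the outer maps) are the restrictions of the interface maps of $\mathcal{G}$, viewed as landing in $\mathcal{L}^\bot$. -}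

module Defs where

open import Level using (0ℓ)
open import Data.Nat using (ℕ; _≤_)
open import Data.Fin using (Fin)
open import Data.Fin.Properties using (any?) renaming (_≟_ to _≟F_)
open import Data.List using (List; length; map; filter; allFin)
open import Data.Nat.ListAction using (sum)
open import Data.List.Membership.Propositional using (_∈_)
open import Data.List.Relation.Unary.Unique.Propositional using (Unique)
open import Data.Maybe using (Maybe; just; nothing)
open import Data.Product using (Σ; ∃; _×_; _,_; proj₁)
open import Data.Sum using (_⊎_; inj₁; inj₂; [_,_]) renaming (map to map⊎)
open import Data.Empty using (⊥)
open import Function using (_∘_; id)
open import Function.Bundles using (_⇔_)
open import Relation.Nullary using (¬_; Dec)
open import Relation.Nullary.Decidable using (False; ¬?; _×-dec_)
open import Relation.Binary.PropositionalEquality using (_≡_; _≢_)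

record Signature : Set₁ where
  field
    Gen  : Set
    ar   : Gen → ℕ
    coar : Gen → ℕ

record PreEHyp (Sg : Signature) : Set₁ where
  open Signature Sg
  field
    nV nE : ℕ
    s t   : Fin nE → List (Fin nV)
    l     : Fin nE → Maybe Gen          -- nothing = ⊥ (hierarchical)
    -- x' < x : x' is a predecessor of x, on V + E
    _<_   : Fin nV ⊎ Fin nE → Fin nV ⊎ Fin nE → Set
    _⌣_   : Fin nV ⊎ Fin nE → Fin nV ⊎ Fin nE → Set

module PreNotions {Sg : Signature} (G : PreEHyp Sg) where
  open PreEHyp G public

  Elt : Set
  Elt = Fin nV ⊎ Fin nE

  Hierarchical : Fin nE → Set
  Hierarchical e = l e ≡ nothing

  ImmPred : Fin nE → Elt → Set
  ImmPred e x = (inj₂ e < x) × (∀ y → ¬ ((inj₂ e < y) × (y < x)))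

  TopLevel : Elt → Set
  TopLevel x = ∀ y → ¬ (y < x)

  Incident : Fin nV → Fin nE → Set
  Incident v e = (v ∈ s e) ⊎ (v ∈ t e)

record EHyp (Sg : Signature) : Set₁ where
  open Signature Sg
  field
    pre : PreEHyp Sg
  open PreNotions pre
  field
    arity     : ∀ e σ → l e ≡ just σ → (length (s e) ≡ ar σ) × (length (t e) ≡ coar σ)
    <-irrefl  : ∀ x → ¬ (x < x)
    <-trans   : ∀ x y z → x < y → y < z → x < z
    pred-hier : ∀ y x → y < x → Σ (Fin nE) λ e → (y ≡ inj₂ e) × Hierarchical e
    imm-uniq  : ∀ e e' x → ImmPred e x → ImmPred e' x → e ≡ e'
    leaf-lab  : ∀ e → (∀ x → ¬ (inj₂ e < x)) → ¬ Hierarchical e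
    inc-imm   : ∀ e v → Incident v e → ∀ e' → ImmPred e' (inj₂ e) ⇔ ImmPred e' (inj₁ v)
    -- ⌣ is a union of equivalence relations ⌣_p on the immediate children of hierarchical p
    ⌣-par     : ∀ x y → x ⌣ y → Σ (Fin nE) λ p → Hierarchical p × ImmPred p x × ImmPred p y
    ⌣-refl    : ∀ p x → Hierarchical p → ImmPred p x → x ⌣ x
    ⌣-sym     : ∀ x y → x ⌣ y → y ⌣ x
    ⌣-trans   : ∀ x y z → x ⌣ y → y ⌣ z → x ⌣ z
    ⌣-conn    : ∀ p e v → ImmPred p (inj₂ e) → ImmPred p (inj₁ v) → Incident v e → inj₂ e ⌣ inj₁ v

module Notions {Sg : Signature} (G : EHyp Sg) where
  open EHyp G public using (pre)
  open PreNotions (EHyp.pre G) public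

  V : Set
  V = Fin nV

  E : Set
  E = Fin nE

  data Path : V → V → Set where
    []   : ∀ {v} → Path v v
    step : ∀ {u v w} (e : E) → u ∈ s e → v ∈ t e → Path v w → Path u w

  Inside : (V → Set) → (E → Set) → ∀ {u w} → Path u w → Set
  Inside P Q {u} []               = P u
  Inside P Q {u} (step e _ _ p)   = P u × Q e × Inside P Q p

  Step : V → V → Set
  Step v w = Σ E λ e → (v ∈ s e) × (w ∈ t e)

  data Step⁺ : V → V → Set where
    [_] : ∀ {u v} → Step u v → Step⁺ u v
    _∷_ : ∀ {u v w} → Step u v → Step⁺ v w → Step⁺ u w

  Acyclic : Set
  Acyclic = ∀ v → ¬ Step⁺ v v

  count : V → List V → ℕ
  count v xs = length (filter (_≟F v) xs)

  inDeg outDeg : V → ℕ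
  inDeg  v = sum (map (λ e → count v (t e)) (allFin nE))
  outDeg v = sum (map (λ e → count v (s e)) (allFin nE))

  HasSize : (V → Set) → ℕ → Set
  HasSize P k = Σ (List V) λ xs → Unique xs × (∀ v → (v ∈ xs) ⇔ P v) × (length xs ≡ k)

record Hom {Sg : Signature} (G H : EHyp Sg) : Set where
  private
    module G = Notions G
    module H = Notions H
  field
    fV : G.V → H.V
    fE : G.E → H.E
  fElt : G.Elt → H.Elt
  fElt = map⊎ fV fE
  field
    pres-s   : ∀ e → map fV (G.s e) ≡ H.s (fE e)
    pres-t   : ∀ e → map fV (G.t e) ≡ H.t (fE e)
    pres-l   : ∀ e → H.l (fE e) ≡ G.l e
    pres-imm : ∀ e x → G.ImmPred e x → H.ImmPred (fE e) (fElt x)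
    pres-⌣   : ∀ x y → x G.⌣ y → fElt x H.⌣ fElt y

open Hom public

HomEq : ∀ {Sg} {G H : EHyp Sg} → Hom G H → Hom G H → Set
HomEq f h = (∀ v → fV f v ≡ fV h v) × (∀ e → fE f e ≡ fE h e)

IsMono : ∀ {Sg} {L G : EHyp Sg} → Hom L G → Set₁
IsMono {Sg} {L} {G} m =
  ∀ (H : EHyp Sg) (f h : Hom H L) →
    (∀ v → fV m (fV f v) ≡ fV m (fV h v)) →
    (∀ e → fE m (fE f e) ≡ fE m (fE h e)) →
    HomEq f h

Agree : ∀ {Sg} {A B C : EHyp Sg} → Hom A B → Hom B C → Hom A C → Set
Agree f h k = (∀ v → fV h (fV f v) ≡ fV k v) × (∀ e → fE h (fE f e) ≡ fE k e)

-- G is the pushout of L <-a- D -c-> Lb (D discrete, homs out of D = vertex maps),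
-- with legs m : L → G and g : Lb → G
IsPushout : ∀ {Sg} {D : Set} {L Lb G : EHyp Sg} →
  (D → Notions.V L) → (D → Notions.V Lb) → Hom L G → Hom Lb G → Set₁
IsPushout {Sg} {D} {L} {Lb} {G} a c m g =
  (∀ d → fV m (a d) ≡ fV g (c d)) ×
  (∀ (H : EHyp Sg) (h₁ : Hom L H) (h₂ : Hom Lb H) →
     (∀ d → fV h₁ (a d) ≡ fV h₂ (c d)) →
     Σ (Hom G H) λ u → Agree m u h₁ × Agree g u h₂ ×
       (∀ (u' : Hom G H) → Agree m u' h₁ → Agree g u' h₂ → HomEq u u'))

-- Extended cospans  A -inO-> A' -inL-> G <-outL- B' <-outO- B
-- (interfaces are discrete; maps out of them are functions)

Injective : {A B : Set} → (A → B) → Set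
Injective f = ∀ x y → f x ≡ f y → x ≡ y

module _ {Sg : Signature} (G : EHyp Sg) {A A' B' B : Set}
         (inO : A → A') (inL : A' → Notions.V G) (outL : B' → Notions.V G) (outO : B → B') where
  open Notions G

  StrictlyInternalIn : V → Set
  StrictlyInternalIn v = Σ A' λ a' → (inL a' ≡ v) × ¬ (Σ A λ a → inO a ≡ a')

  StrictlyInternalOut : V → Set
  StrictlyInternalOut v = Σ B' λ b' → (outL b' ≡ v) × ¬ (Σ B λ b → outO b ≡ b')

  IsExtCospan : Set
  IsExtCospan =
    Injective inO × Injective outO ×
    (∀ a → TopLevel (inj₁ (inL (inO a)))) ×
    (∀ b → TopLevel (inj₁ (outL (outO b)))) ×
    (∀ v → StrictlyInternalIn v → ¬ TopLevel (inj₁ v)) ×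
    (∀ v → StrictlyInternalOut v → ¬ TopLevel (inj₁ v))

  IsMDA : Set
  IsMDA =
    IsExtCospan × Acyclic × Injective inL × Injective outL ×
    (∀ v → inDeg v ≤ 1) × (∀ v → outDeg v ≤ 1) ×
    (∀ v → (inDeg v ≡ 0) ⇔ (Σ A' λ a' → inL a' ≡ v)) ×
    (∀ v → (outDeg v ≡ 0) ⇔ (Σ B' λ b' → outL b' ≡ v))

  WellTypedEdge : E → Set
  WellTypedEdge e =
    (∀ w → StrictlyInternalIn w → ImmPred e (inj₁ w) →
       HasSize (λ v → StrictlyInternalIn v × ImmPred e (inj₁ v) × (inj₁ v ⌣ inj₁ w)) (length (s e))) ×
    (∀ w → StrictlyInternalOut w → ImmPred e (inj₁ w) →
       HasSize (λ v → StrictlyInternalOut v × ImmPred e (inj₁ v) × (inj₁ v ⌣ inj₁ w)) (length (t e)))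

  WellTyped : Set
  WellTyped = ∀ e → Hierarchical e → WellTypedEdge e

record Cospan {Sg : Signature} (G : EHyp Sg) : Set where
  field
    ni ni' no' no : ℕ
    inO  : Fin ni → Fin ni'
    inL  : Fin ni' → Notions.V G
    outL : Fin no' → Notions.V G
    outO : Fin no → Fin no'

  ext : Fin ni ⊎ Fin no → Notions.V G
  ext = [ inL ∘ inO , outL ∘ outO ]

  MDA : Set
  MDA = IsMDA G inO inL outL outO

BoundaryOK : ∀ {Sg} (H : EHyp Sg) {D : Set} → (D → Notions.V H) → Set
BoundaryOK H {D} f =
  (∀ d d' y → (y < inj₁ (f d)) ⇔ (y < inj₁ (f d'))) ×
  ((∀ d → TopLevel (inj₁ (f d))) ⊎ (∀ d d' → inj₁ (f d) ⌣ inj₁ (f d')))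
  where open Notions H

module BC {Sg : Signature} {L G : EHyp Sg} (CL : Cospan L) (CG : Cospan G) (m : Hom L G) where
  private
    module L = Notions L
    module G = Notions G
    module CL = Cospan CL
    module CG = Cospan CG

  D : Set
  D = Fin CL.ni ⊎ Fin CL.no

  a : D → L.V
  a = CL.ext

  IdentIn : Fin CG.ni' → Set
  IdentIn y = Σ (Fin CL.ni') λ x' → (¬ Σ (Fin CL.ni) λ x → CL.inO x ≡ x') × (CG.inL y ≡ fV m (CL.inL x'))

  IdentIn? : ∀ y → Dec (IdentIn y)
  IdentIn? y = any? (λ x' → ¬? (any? (λ x → CL.inO x ≟F x')) ×-dec (CG.inL y ≟F fV m (CL.inL x')))

  IdentOut : Fin CG.no' → Set
  IdentOut y = Σ (Fin CL.no') λ x' → (¬ Σ (Fin CL.no) λ x → CL.outO x ≡ x') × (CG.outL y ≡ fV m (CL.outL x'))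

  IdentOut? : ∀ y → Dec (IdentOut y)
  IdentOut? y = any? (λ x' → ¬? (any? (λ x → CL.outO x ≟F x')) ×-dec (CG.outL y ≟F fV m (CL.outL x')))

  -- n' \ (i' \ i)   and   k' \ (j' \ j)
  SubIn : Set
  SubIn = Σ (Fin CG.ni') λ y → False (IdentIn? y)

  SubOut : Set
  SubOut = Σ (Fin CG.no') λ y → False (IdentOut? y)

  InImgV : G.V → Set
  InImgV v = Σ L.V λ u → fV m u ≡ v

  InImgE : G.E → Set
  InImgE e = Σ L.E λ e' → fE m e' ≡ e

  InImg : G.Elt → Set
  InImg (inj₁ v) = InImgV v
  InImg (inj₂ e) = InImgE e

  Convex : Set
  Convex = ∀ v w → InImgV v → InImgV w → (p : G.Path v w) → G.Inside InImgV InImgE p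

  DownClosed : Set
  DownClosed = ∀ e → InImgE e → ∀ x → G.ImmPred e x → InImg x

  -- restricted interfaces of G landing in Lb, for the cospan of conditions (6)/(7)
  record Restriction (Lb : EHyp Sg) (g : Hom Lb G) : Set where
    field
      g₁ : SubIn → Notions.V Lb
      g₂ : SubOut → Notions.V Lb
      o₁ : Fin CG.ni → SubIn
      o₂ : Fin CG.no → SubOut
      g₁-ok : ∀ y → fV g (g₁ y) ≡ CG.inL (proj₁ y)
      g₂-ok : ∀ y → fV g (g₂ y) ≡ CG.outL (proj₁ y)
      o₁-ok : ∀ x → proj₁ (o₁ x) ≡ CG.inO x
      o₂-ok : ∀ x → proj₁ (o₂ x) ≡ CG.outO x

  record BoundaryComplement : Set₁ where
    field
      Lb : EHyp Sg
      c  : D → Notions.V Lb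
      g  : Hom Lb G
      pushout : IsPushout a c m g
      convex     : Convex
      downClosed : DownClosed
      c-mono : Injective c
      bdG : BoundaryOK G (fV m ∘ a)
      bdLb : BoundaryOK Lb c
      d₁ : Fin CG.ni → Notions.V Lb
      d₂ : Fin CG.no → Notions.V Lb
      d₁-ok : ∀ x → fV g (d₁ x) ≡ CG.inL (CG.inO x)
      d₂-ok : ∀ x → fV g (d₂ x) ≡ CG.outL (CG.outO x)
      top :
        (∀ d → G.TopLevel (inj₁ (fV m (a d)))) →
        Σ (Restriction Lb g) λ R → let open Restriction R in
          IsMDA Lb (map⊎ o₁ id) [ g₁ , c ∘ inj₂ ] [ g₂ , c ∘ inj₁ ] (map⊎ o₂ id) ×
          WellTyped Lb (map⊎ o₁ id) [ g₁ , c ∘ inj₂ ] [ g₂ , c ∘ inj₁ ] (map⊎ o₂ id)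
      nontop :
        (∀ d → ¬ G.TopLevel (inj₁ (fV m (a d)))) →
        Σ (Restriction Lb g) λ R → let open Restriction R in
          IsMDA Lb (inj₁ ∘ o₁) [ g₁ , c ∘ inj₂ ] [ g₂ , c ∘ inj₁ ] (inj₁ ∘ o₂)

  Isomorphic : BoundaryComplement → BoundaryComplement → Set
  Isomorphic B₁ B₂ =
    Σ (Hom (BoundaryComplement.Lb B₁) (BoundaryComplement.Lb B₂)) λ φ →
    Σ (Hom (BoundaryComplement.Lb B₂) (BoundaryComplement.Lb B₁)) λ ψ →
      (∀ v → fV ψ (fV φ v) ≡ v) × (∀ e → fE ψ (fE φ e) ≡ e) ×
      (∀ v → fV φ (fV ψ v) ≡ v) × (∀ e → fE φ (fE ψ e) ≡ e) ×
      (∀ d → fV φ (BoundaryComplement.c B₁ d) ≡ BoundaryComplement.c B₂ d) ×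
      Agree φ (BoundaryComplement.g B₂) (BoundaryComplement.g B₁)

{-# OPTIONS --safe #-}
-- Glue L and a boundary complement Lb along the interface: replace each c d by
-- a d, and hang the part of L connected to the interface (which is top-level)
-- below the common parent of the c d in Lb, if they have one.  This gives an
-- e-hypergraph H with maps L → H ← Lb and a map back to G.  By the pushout
-- property G → H → G is the identity, so G behaves like the gluing: every vertex
-- and edge of G comes from L or Lb, g is injective away from the interface and
-- misses the edges of m, and g reflects immediate predecessors and ⌣.
--
-- For two complements Lb, Lb', send the interface of Lb to that of Lb' and every
-- other vertex or edge x to the g'-preimage of g x.  This preserves sources and
-- targets: by the MDA conditions on the complement, a source (target) in Lb is
-- glued only to outputs (inputs) of L, on which the interface map of L is
-- injective, so g' is injective on such vertices.  The map built the other way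
-- round is its inverse.
module Submission where

open import Defs
open import Data.Nat using (ℕ; zero; suc; _+_)
open import Data.Nat.Properties using (<⇒≢; m+n≡0⇒m≡0; m+n≡0⇒n≡0)
open import Data.Nat.ListAction using (sum)
open import Data.Fin using (Fin; zero; suc; splitAt; join)
open import Data.Fin.Properties using (any?; splitAt-join; join-splitAt) renaming (_≟_ to _≟F_)
open import Data.List using (List; []; _∷_; map; length; filter; allFin)
open import Data.List.Properties using (map-id; map-∘; map-cong; length-map; filter-some; ∷-injectiveˡ; ∷-injectiveʳ)
open import Data.List.Membership.Propositional using (_∈_)
open import Data.List.Membership.Propositional.Properties using (∈-map⁺; ∈-map⁻; ∈-allFin)
open import Data.List.Relation.Unary.All using (All; []; _∷_; tabulate)
open import Data.List.Relation.Unary.All.Properties using (gmap⁺)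
open import Data.List.Relation.Unary.Any using (here; there)
import Data.List.Relation.Unary.Any as Any
open import Data.Maybe using (Maybe; just; nothing)
open import Data.Product using (Σ; _×_; _,_; proj₁; proj₂)
open import Data.Sum using (_⊎_; inj₁; inj₂; [_,_]) renaming (map to map⊎)
open import Data.Sum.Properties using (inj₁-injective; inj₂-injective)
open import Data.Empty using (⊥; ⊥-elim)
open import Data.Unit using (⊤; tt)
open import Function using (_∘_; id)
open import Function.Bundles using (_⇔_; Equivalence; mk⇔)
open import Relation.Nullary using (¬_; Dec; yes; no)
open import Relation.Nullary.Decidable using (¬¬-excluded-middle)
open import Relation.Binary.PropositionalEquality using (_≡_; _≢_; refl; sym; trans; cong; cong₂; subst; subst₂; module ≡-Reasoning)
open ≡-Reasoning

¬¬-∀-Fin : ∀ n (Q : Fin n → Set) → (∀ i → ¬ ¬ Q i) → ¬ ¬ (∀ i → Q i)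
¬¬-∀-Fin zero    Q ¬¬Q k = k (λ ())
¬¬-∀-Fin (suc n) Q ¬¬Q k =
  ¬¬Q zero λ q₀ → ¬¬-∀-Fin n (Q ∘ suc) (¬¬Q ∘ suc) λ qₛ → k λ { zero → q₀ ; (suc i) → qₛ i }

∈⇒count≢0 : ∀ {n} {v : Fin n} {xs} → v ∈ xs → length (filter (_≟F v) xs) ≢ 0
∈⇒count≢0 v∈xs count≡0 = <⇒≢ (filter-some (_≟F _) (Any.map sym v∈xs)) (sym count≡0)

sum-map≡0⇒≡0 : ∀ {A : Set} (f : A → ℕ) xs → sum (map f xs) ≡ 0 → ∀ {x} → x ∈ xs → f x ≡ 0
sum-map≡0⇒≡0 f (y ∷ xs) eq (here refl)  = m+n≡0⇒m≡0 (f y) eq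
sum-map≡0⇒≡0 f (y ∷ xs) eq (there x∈xs) = sum-map≡0⇒≡0 f xs (m+n≡0⇒n≡0 (f y) eq) x∈xs

map-injectiveOn : ∀ {A B : Set} (f : A → B) (Q : A → Set) →
  (∀ a b → Q a → Q b → f a ≡ f b → a ≡ b) →
  ∀ xs ys → All Q xs → All Q ys → map f xs ≡ map f ys → xs ≡ ys
map-injectiveOn f Q inj []       []       _          _          _  = refl
map-injectiveOn f Q inj (x ∷ xs) (y ∷ ys) (qx ∷ qxs) (qy ∷ qys) eq =
  cong₂ _∷_ (inj x y qx qy (∷-injectiveˡ eq)) (map-injectiveOn f Q inj xs ys qxs qys (∷-injectiveʳ eq))

module EHypProperties {Sg : Signature} (X : EHyp Sg) where
  open Notions X
  open EHyp X

  _⋖_ : Elt → Elt → Set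
  y ⋖ x = (y < x) × (∀ z → ¬ ((y < z) × (z < x)))

  ⋖⇒edge : ∀ {y x} → y ⋖ x → Σ E λ e → y ≡ inj₂ e
  ⋖⇒edge {y} {x} (y<x , _) with pred-hier y x y<x
  ... | e , y≡e , _ = e , y≡e

  ⋖-unique : ∀ {y y' x} → y ⋖ x → y' ⋖ x → y ≡ y'
  ⋖-unique {x = x} i i' with ⋖⇒edge i | ⋖⇒edge i'
  ... | e , refl | e' , refl = cong inj₂ (imm-uniq e e' x i i')

  immPred⇒hierarchical : ∀ {e x} → ImmPred e x → Hierarchical e
  immPred⇒hierarchical {e} {x} (e<x , _) with pred-hier (inj₂ e) x e<x
  ... | _ , refl , h = h

  -- Immediate predecessors exist only classically (< is not decidable), but
  -- under ¬ ¬ we may decide < and take a maximal predecessor.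
  module MaximalPredecessor (x : Elt) (e₀ : E) (e₀<x : inj₂ e₀ < x)
           (_<x? : ∀ e → Dec (inj₂ e < x)) (_<?_ : ∀ e e' → Dec (inj₂ e < inj₂ e')) where

    maximalAmong : (es : List E) →
      Σ E λ e → (inj₂ e < x) × (∀ e' → e' ∈ es → inj₂ e' < x → ¬ (inj₂ e < inj₂ e'))
    maximalAmong [] = e₀ , e₀<x , λ _ ()
    maximalAmong (e' ∷ es) with maximalAmong es | e' <x?
    ... | e , e<x , max | no e'≮x = e , e<x , max'
      where
      max' : ∀ e'' → e'' ∈ e' ∷ es → inj₂ e'' < x → ¬ (inj₂ e < inj₂ e'')
      max' _ (here refl) e'<x _  = e'≮x e'<x
      max' _ (there e''∈) e''<x  = max _ e''∈ e''<x
    ... | e , e<x , max | yes e'<x with e <? e'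
    ...   | yes e<e' = e' , e'<x , max'
      where
      max' : ∀ e'' → e'' ∈ e' ∷ es → inj₂ e'' < x → ¬ (inj₂ e' < inj₂ e'')
      max' _ (here refl) _ e'<e'       = <-irrefl _ e'<e'
      max' _ (there e''∈) e''<x e'<e'' = max _ e''∈ e''<x (<-trans _ _ _ e<e' e'<e'')
    ...   | no e≮e' = e , e<x , max'
      where
      max' : ∀ e'' → e'' ∈ e' ∷ es → inj₂ e'' < x → ¬ (inj₂ e < inj₂ e'')
      max' _ (here refl) _ = e≮e'
      max' _ (there e''∈)  = max _ e''∈

    immPred-exists : Σ E λ e → ImmPred e x
    immPred-exists with maximalAmong (allFin nE)
    ... | e , e<x , max = e , e<x , λ { y (e<y , y<x) → immediate y e<y y<x }
      where
      immediate : ∀ y → inj₂ e < y → ¬ y < x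
      immediate y e<y y<x with pred-hier y x y<x
      ... | e' , refl , _ = max e' (∈-allFin e') y<x e<y

  ¬¬immPred-exists : ∀ y x → y < x → ¬ ¬ (Σ E λ e → ImmPred e x)
  ¬¬immPred-exists y x y<x k with pred-hier y x y<x
  ... | e₀ , refl , _ =
    ¬¬-∀-Fin nE _ (λ _ → ¬¬-excluded-middle) λ _<x? →
    ¬¬-∀-Fin nE _ (λ e → ¬¬-∀-Fin nE _ (λ _ → ¬¬-excluded-middle)) λ _<?_ →
    k (MaximalPredecessor.immPred-exists x e₀ y<x _<x? _<?_)

  ⌣⇒¬topLevel : ∀ {x y} → x ⌣ y → ¬ TopLevel y
  ⌣⇒¬topLevel {x} {y} s top with ⌣-par x y s
  ... | p , _ , _ , p⋖y = top (inj₂ p) (proj₁ p⋖y)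

  inDeg≡0⇒∉t : ∀ {v} → inDeg v ≡ 0 → ∀ e → ¬ (v ∈ t e)
  inDeg≡0⇒∉t {v} deg e v∈t = ∈⇒count≢0 v∈t (sum-map≡0⇒≡0 (λ e → count v (t e)) (allFin nE) deg (∈-allFin e))

  outDeg≡0⇒∉s : ∀ {v} → outDeg v ≡ 0 → ∀ e → ¬ (v ∈ s e)
  outDeg≡0⇒∉s {v} deg e v∈s = ∈⇒count≢0 v∈s (sum-map≡0⇒≡0 (λ e → count v (s e)) (allFin nE) deg (∈-allFin e))

  topLevel-vertex⇒edge : ∀ {w e} → Incident w e → TopLevel (inj₁ w) → TopLevel (inj₂ e)
  topLevel-vertex⇒edge {w} {e} inc top y y<e =
    ¬¬immPred-exists y (inj₂ e) y<e λ (p , p⋖e) → top (inj₂ p) (proj₁ (Equivalence.to (inc-imm e w inc p) p⋖e))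

  topLevel-edge⇒vertex : ∀ {w e} → Incident w e → TopLevel (inj₂ e) → TopLevel (inj₁ w)
  topLevel-edge⇒vertex {w} {e} inc top y y<w =
    ¬¬immPred-exists y (inj₁ w) y<w λ (p , p⋖w) → top (inj₂ p) (proj₁ (Equivalence.from (inc-imm e w inc p) p⋖w))

  ⋖-incident : ∀ {w e y} → Incident w e → y ⋖ inj₂ e ⇔ y ⋖ inj₁ w
  ⋖-incident {w} {e} inc = mk⇔ to from
    where
    to : ∀ {y} → y ⋖ inj₂ e → y ⋖ inj₁ w
    to i with ⋖⇒edge i
    ... | p , refl = Equivalence.to (inc-imm e w inc p) i
    from : ∀ {y} → y ⋖ inj₁ w → y ⋖ inj₂ e
    from i with ⋖⇒edge i
    ... | p , refl = Equivalence.from (inc-imm e w inc p) i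

mda-interface-degrees : ∀ {Sg} {X : EHyp Sg} {A A' B' B : Set}
  {inO : A → A'} {inL : A' → Notions.V X} {outL : B' → Notions.V X} {outO : B → B'} →
  IsMDA X inO inL outL outO → (∀ a' → Notions.inDeg X (inL a') ≡ 0) × (∀ b' → Notions.outDeg X (outL b') ≡ 0)
mda-interface-degrees (_ , _ , _ , _ , _ , _ , inDeg≡0⇔in , outDeg≡0⇔out) =
  (λ a' → Equivalence.from (inDeg≡0⇔in _) (a' , refl)) , (λ b' → Equivalence.from (outDeg≡0⇔out _) (b' , refl))

idHom : ∀ {Sg} (X : EHyp Sg) → Hom X X
idHom X = record
  { fV = id ; fE = id
  ; pres-s = λ _ → map-id _ ; pres-t = λ _ → map-id _ ; pres-l = λ _ → refl
  ; pres-imm = λ { e (inj₁ _) i → i ; e (inj₂ _) i → i }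
  ; pres-⌣ = λ { (inj₁ _) (inj₁ _) s → s ; (inj₁ _) (inj₂ _) s → s ; (inj₂ _) (inj₁ _) s → s ; (inj₂ _) (inj₂ _) s → s }
  }

fElt-∘ : ∀ {Sg} {A B C : EHyp Sg} (f : Hom A B) (h : Hom B C) x →
  fElt h (fElt f x) ≡ map⊎ (fV h ∘ fV f) (fE h ∘ fE f) x
fElt-∘ f h (inj₁ _) = refl
fElt-∘ f h (inj₂ _) = refl

_⨾_ : ∀ {Sg} {A B C : EHyp Sg} → Hom A B → Hom B C → Hom A C
_⨾_ {C = C} f h = record
  { fV = fV h ∘ fV f ; fE = fE h ∘ fE f
  ; pres-s = λ e → trans (map-∘ _) (trans (cong (map (fV h)) (pres-s f e)) (pres-s h (fE f e)))
  ; pres-t = λ e → trans (map-∘ _) (trans (cong (map (fV h)) (pres-t f e)) (pres-t h (fE f e)))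
  ; pres-l = λ e → trans (pres-l h (fE f e)) (pres-l f e)
  ; pres-imm = λ e x i → subst (C.ImmPred _) (fElt-∘ f h x) (pres-imm h _ _ (pres-imm f _ _ i))
  ; pres-⌣ = λ x y s → subst₂ C._⌣_ (fElt-∘ f h x) (fElt-∘ f h y) (pres-⌣ h _ _ (pres-⌣ f _ _ s))
  }
  where module C = Notions C

Hom-incident : ∀ {Sg} {X Y : EHyp Sg} (f : Hom X Y) {w e} →
  Notions.Incident X w e → Notions.Incident Y (fV f w) (fE f e)
Hom-incident f {w} {e} (inj₁ w∈s) = inj₁ (subst (fV f w ∈_) (pres-s f e) (∈-map⁺ (fV f) w∈s))
Hom-incident f {w} {e} (inj₂ w∈t) = inj₂ (subst (fV f w ∈_) (pres-t f e) (∈-map⁺ (fV f) w∈t))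

module Gluing {Sg : Signature} (L Lb : EHyp Sg) {ni nk : ℕ}
  (a : Fin ni ⊎ Fin nk → Notions.V L) (c : Fin ni ⊎ Fin nk → Notions.V Lb)
  (c-injective : Injective c)
  (a-topLevel : ∀ d → Notions.TopLevel L (inj₁ (a d)))
  (c-boundary : BoundaryOK Lb c) where

  module L = Notions L
  module Lb = Notions Lb
  module EL = EHyp L
  module ELb = EHyp Lb
  module FL = EHypProperties L
  module FLb = EHypProperties Lb

  D : Set
  D = Fin ni ⊎ Fin nk

  Boundary : Lb.V → Set
  Boundary v = Σ D λ d → c d ≡ v

  boundary? : ∀ v → Dec (Boundary v)
  boundary? v with any? (λ i → c (inj₁ i) ≟F v) | any? (λ j → c (inj₂ j) ≟F v)
  ... | yes (i , eq) | _            = yes (inj₁ i , eq)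
  ... | no _         | yes (j , eq) = yes (inj₂ j , eq)
  ... | no ¬i        | no ¬j        = no λ { (inj₁ i , eq) → ¬i (i , eq) ; (inj₂ j , eq) → ¬j (j , eq) }

  glueV : Lb.V → L.V ⊎ Lb.V
  glueV v with boundary? v
  ... | yes (d , _) = inj₁ (a d)
  ... | no _        = inj₂ v

  glueV-c : ∀ d → glueV (c d) ≡ inj₁ (a d)
  glueV-c d with boundary? (c d)
  ... | yes (d' , cd'≡cd) = cong (inj₁ ∘ a) (c-injective d' d cd'≡cd)
  ... | no ¬b             = ⊥-elim (¬b (d , refl))

  glueV-interior : ∀ {v} → ¬ Boundary v → glueV v ≡ inj₂ v
  glueV-interior {v} ¬b with boundary? v
  ... | yes b = ⊥-elim (¬b b)
  ... | no _  = refl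

  boundary-elim : (Q : Lb.V → Set) → (∀ d → Q (c d)) → (∀ {v} → ¬ Boundary v → Q v) → ∀ v → Q v
  boundary-elim Q on-boundary on-interior v with boundary? v
  ... | yes (d , refl) = on-boundary d
  ... | no ¬b          = on-interior ¬b

  GluedOnlyFrom : (D → Set) → Lb.V → Set
  GluedOnlyFrom P v = ∀ d → c d ≡ v → P d

  record Anchor : Set where
    field
      parent     : Lb.E
      parent-imm : ∀ d → Lb.ImmPred parent (inj₁ (c d))
  open Anchor

  anchor-unique : (A A' : Anchor) → D → parent A ≡ parent A'
  anchor-unique A A' d = ELb.imm-uniq _ _ _ (parent-imm A d) (parent-imm A' d)

  anchor-hierarchical : (A : Anchor) → D → Lb.Hierarchical (parent A)
  anchor-hierarchical A d = FLb.immPred⇒hierarchical (parent-imm A d)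

  boundary-⌣ : ∀ {d q} → Lb.ImmPred q (inj₁ (c d)) → ∀ d₁ d₂ → inj₁ (c d₁) Lb.⌣ inj₁ (c d₂)
  boundary-⌣ {d} {q} q⋖cd with proj₂ c-boundary
  ... | inj₁ allTop = ⊥-elim (allTop d (inj₂ q) (proj₁ q⋖cd))
  ... | inj₂ ⌣-all  = ⌣-all

  anchor-of : ∀ {d q} → Lb.ImmPred q (inj₁ (c d)) → Σ Anchor λ A → parent A ≡ q
  anchor-of {d} {q} q⋖cd = record { parent = q ; parent-imm = imm } , refl
    where
    imm : ∀ d' → Lb.ImmPred q (inj₁ (c d'))
    imm d' with ELb.⌣-par _ _ (boundary-⌣ q⋖cd d' d)
    ... | _ , _ , p⋖cd' , p⋖cd = subst (λ p → Lb.ImmPred p (inj₁ (c d'))) (ELb.imm-uniq _ _ _ p⋖cd q⋖cd) p⋖cd'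

  ⌣-boundary⇒anchor : ∀ {y d} → y Lb.⌣ inj₁ (c d) → Anchor
  ⌣-boundary⇒anchor s with ELb.⌣-par _ _ s
  ... | _ , _ , _ , p⋖cd = proj₁ (anchor-of p⋖cd)

  ⌣-boundary⇒boundary-⌣ : ∀ {y d} → y Lb.⌣ inj₁ (c d) → ∀ d₁ d₂ → inj₁ (c d₁) Lb.⌣ inj₁ (c d₂)
  ⌣-boundary⇒boundary-⌣ s with ELb.⌣-par _ _ s
  ... | _ , _ , _ , p⋖cd = boundary-⌣ p⋖cd

  AtOrAbove : Anchor → Lb.Elt → Set
  AtOrAbove A y = (y ≡ inj₂ (parent A)) ⊎ (y Lb.< inj₂ (parent A))

  -- In the gluing these elements become children of the anchor.
  data Attached : L.Elt → Set where
    interface : ∀ d → Attached (inj₁ (a d))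
    to-edge   : ∀ {w e} → Attached (inj₁ w) → L.Incident w e → Attached (inj₂ e)
    to-vertex : ∀ {w e} → Attached (inj₂ e) → L.Incident w e → Attached (inj₁ w)

  attached-topLevel : ∀ {x} → Attached x → L.TopLevel x
  attached-topLevel (interface d)     = a-topLevel d
  attached-topLevel (to-edge w inc)   = FL.topLevel-vertex⇒edge inc (attached-topLevel w)
  attached-topLevel (to-vertex e inc) = FL.topLevel-edge⇒vertex inc (attached-topLevel e)

  attached-source : ∀ {x} → Attached x → D
  attached-source (interface d)   = d
  attached-source (to-edge w _)   = attached-source w
  attached-source (to-vertex e _) = attached-source e

  ⌣-¬attached : ∀ {x y} → x L.⌣ y → ¬ Attached y
  ⌣-¬attached s att = FL.⌣⇒¬topLevel s (attached-topLevel att)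

  AttachedOrBelow : L.Elt → Set
  AttachedOrBelow x = Σ L.Elt λ z → Attached z × ((z ≡ x) ⊎ (z L.< x))

  -- Elements of the gluing, before encoding them as Fin-indexed vertices and edges.
  Eltᵍ : Set
  Eltᵍ = L.Elt ⊎ Lb.Elt

  vertexᵍ : L.V ⊎ Lb.V → Eltᵍ
  vertexᵍ = map⊎ inj₁ inj₁

  edgeᵍ : L.E ⊎ Lb.E → Eltᵍ
  edgeᵍ = map⊎ inj₂ inj₂

  labᵍ : L.E ⊎ Lb.E → Maybe (Signature.Gen Sg)
  labᵍ = [ L.l , Lb.l ]

  Hierarchicalᵍ : L.E ⊎ Lb.E → Set
  Hierarchicalᵍ e = labᵍ e ≡ nothing

  _<ᵍ_ : Eltᵍ → Eltᵍ → Set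
  inj₁ y <ᵍ inj₁ x = y L.< x
  inj₁ y <ᵍ inj₂ x = ⊥
  inj₂ y <ᵍ inj₁ x = Σ Anchor λ A → AtOrAbove A y × AttachedOrBelow x
  inj₂ y <ᵍ inj₂ x = y Lb.< x

  _⌣ᵍ_ : Eltᵍ → Eltᵍ → Set
  inj₁ x ⌣ᵍ inj₁ y = (x L.⌣ y) ⊎ (Anchor × Attached x × Attached y)
  inj₁ x ⌣ᵍ inj₂ y = Attached x × Σ D λ d → y Lb.⌣ inj₁ (c d)
  inj₂ y ⌣ᵍ inj₁ x = Attached x × Σ D λ d → y Lb.⌣ inj₁ (c d)
  inj₂ x ⌣ᵍ inj₂ y = x Lb.⌣ y

  _⋖ᵍ_ : Eltᵍ → Eltᵍ → Set
  z ⋖ᵍ w = (z <ᵍ w) × (∀ y → ¬ ((z <ᵍ y) × (y <ᵍ w)))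

  ⋖ᵍ⇒⋖L : ∀ {y x} → inj₁ y ⋖ᵍ inj₁ x → y FL.⋖ x
  ⋖ᵍ⇒⋖L (y<x , imm) = y<x , λ z → imm (inj₁ z)

  ⋖L⇒⋖ᵍ : ∀ {y x} → y FL.⋖ x → inj₁ y ⋖ᵍ inj₁ x
  ⋖L⇒⋖ᵍ (y<x , imm) = y<x , λ { (inj₁ z) → imm z ; (inj₂ z) (() , _) }

  ⋖ᵍ⇒⋖Lb : ∀ {y x} → inj₂ y ⋖ᵍ inj₂ x → y FLb.⋖ x
  ⋖ᵍ⇒⋖Lb (y<x , imm) = y<x , λ z → imm (inj₂ z)

  ⋖Lb⇒⋖ᵍ : ∀ {y x} → y FLb.⋖ x → inj₂ y ⋖ᵍ inj₂ x
  ⋖Lb⇒⋖ᵍ (y<x , imm) = y<x , λ { (inj₂ z) → imm z ; (inj₁ z) (_ , ()) }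

  ¬L⋖ᵍLb : ∀ {y x} → ¬ (inj₁ y ⋖ᵍ inj₂ x)
  ¬L⋖ᵍLb (() , _)

  Lb⋖ᵍL⇒anchor : ∀ {y x} → inj₂ y ⋖ᵍ inj₁ x → Σ Anchor λ A → (y ≡ inj₂ (parent A)) × Attached x
  Lb⋖ᵍL⇒anchor ((A , above , z , att , inj₂ z<x) , imm) = ⊥-elim (imm (inj₁ z) ((A , above , z , att , inj₁ refl) , z<x))
  Lb⋖ᵍL⇒anchor ((A , inj₂ y<P , z , att , inj₁ refl) , imm) = ⊥-elim (imm (inj₂ (inj₂ (parent A))) (y<P , A , inj₁ refl , z , att , inj₁ refl))
  Lb⋖ᵍL⇒anchor ((A , inj₁ y≡P , z , att , inj₁ refl) , _) = A , y≡P , att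

  anchor⋖ᵍattached : ∀ (A : Anchor) {x} → Attached x → inj₂ (inj₂ (parent A)) ⋖ᵍ inj₁ x
  anchor⋖ᵍattached A {x} att = (A , inj₁ refl , x , att , inj₁ refl) , imm
    where
    imm : ∀ y → ¬ ((inj₂ (inj₂ (parent A)) <ᵍ y) × (y <ᵍ inj₁ x))
    imm (inj₁ z) (_ , z<x) = attached-topLevel att z z<x
    imm (inj₂ z) (P<z , A' , above , _) rewrite anchor-unique A' A (attached-source att) with above
    ... | inj₁ refl = ELb.<-irrefl _ P<z
    ... | inj₂ z<P  = ELb.<-irrefl _ (ELb.<-trans _ _ _ P<z z<P)

  <ᵍ-irrefl : ∀ z → ¬ (z <ᵍ z)
  <ᵍ-irrefl (inj₁ x) = EL.<-irrefl x
  <ᵍ-irrefl (inj₂ x) = ELb.<-irrefl x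

  <ᵍ-trans : ∀ x y z → x <ᵍ y → y <ᵍ z → x <ᵍ z
  <ᵍ-trans (inj₁ x) (inj₁ y) (inj₁ z) x<y y<z = EL.<-trans _ _ _ x<y y<z
  <ᵍ-trans (inj₂ x) (inj₁ y) (inj₁ z) (A , above , w , att , inj₁ refl) y<z = A , above , w , att , inj₂ y<z
  <ᵍ-trans (inj₂ x) (inj₁ y) (inj₁ z) (A , above , w , att , inj₂ w<y) y<z = A , above , w , att , inj₂ (EL.<-trans _ _ _ w<y y<z)
  <ᵍ-trans (inj₂ x) (inj₂ y) (inj₁ z) x<y (A , inj₁ refl , below) = A , inj₂ x<y , below
  <ᵍ-trans (inj₂ x) (inj₂ y) (inj₁ z) x<y (A , inj₂ y<P , below) = A , inj₂ (ELb.<-trans _ _ _ x<y y<P) , below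
  <ᵍ-trans (inj₂ x) (inj₂ y) (inj₂ z) x<y y<z = ELb.<-trans _ _ _ x<y y<z

  <ᵍ-pred-hier : ∀ z w → z <ᵍ w → Σ (L.E ⊎ Lb.E) λ e → (z ≡ edgeᵍ e) × Hierarchicalᵍ e
  <ᵍ-pred-hier (inj₁ y) (inj₁ x) y<x with EL.pred-hier y x y<x
  ... | e , refl , h = inj₁ e , refl , h
  <ᵍ-pred-hier (inj₂ y) (inj₁ x) (A , inj₁ refl , z , att , _) = inj₂ (parent A) , refl , anchor-hierarchical A (attached-source att)
  <ᵍ-pred-hier (inj₂ y) (inj₁ x) (A , inj₂ y<P , _) with ELb.pred-hier y _ y<P
  ... | e , refl , h = inj₂ e , refl , h
  <ᵍ-pred-hier (inj₂ y) (inj₂ x) y<x with ELb.pred-hier y x y<x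
  ... | e , refl , h = inj₂ e , refl , h

  ⋖ᵍ-unique : ∀ z z' w → z ⋖ᵍ w → z' ⋖ᵍ w → z ≡ z'
  ⋖ᵍ-unique (inj₁ y) (inj₁ y') (inj₁ x) i i' = cong inj₁ (FL.⋖-unique (⋖ᵍ⇒⋖L i) (⋖ᵍ⇒⋖L i'))
  ⋖ᵍ-unique (inj₁ y) (inj₂ y') (inj₁ x) i i' = ⊥-elim (attached-topLevel (proj₂ (proj₂ (Lb⋖ᵍL⇒anchor i'))) y (proj₁ i))
  ⋖ᵍ-unique (inj₂ y) (inj₁ y') (inj₁ x) i i' = ⊥-elim (attached-topLevel (proj₂ (proj₂ (Lb⋖ᵍL⇒anchor i))) y' (proj₁ i'))
  ⋖ᵍ-unique (inj₂ y) (inj₂ y') (inj₁ x) i i' with Lb⋖ᵍL⇒anchor i | Lb⋖ᵍL⇒anchor i'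
  ... | A , refl , att | A' , refl , _ = cong (inj₂ ∘ inj₂) (anchor-unique A A' (attached-source att))
  ⋖ᵍ-unique (inj₁ y) _ (inj₂ x) i i' = ⊥-elim (¬L⋖ᵍLb i)
  ⋖ᵍ-unique (inj₂ y) (inj₁ y') (inj₂ x) i i' = ⊥-elim (¬L⋖ᵍLb i')
  ⋖ᵍ-unique (inj₂ y) (inj₂ y') (inj₂ x) i i' = cong inj₂ (FLb.⋖-unique (⋖ᵍ⇒⋖Lb i) (⋖ᵍ⇒⋖Lb i'))

  Incidentᵍ : L.V ⊎ Lb.V → L.E ⊎ Lb.E → Set
  Incidentᵍ v (inj₁ e) = Σ L.V λ w → (v ≡ inj₁ w) × L.Incident w e
  Incidentᵍ v (inj₂ e) = Σ Lb.V λ w → (v ≡ glueV w) × Lb.Incident w e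

  ⋖ᵍ-incident⁺ : ∀ {v e} z → Incidentᵍ v e → z ⋖ᵍ edgeᵍ e → z ⋖ᵍ vertexᵍ v
  ⋖ᵍ-incident⁺ {e = inj₁ e} (inj₁ y) (w , refl , inc) i = ⋖L⇒⋖ᵍ (Equivalence.to (FL.⋖-incident inc) (⋖ᵍ⇒⋖L i))
  ⋖ᵍ-incident⁺ {e = inj₁ e} (inj₂ y) (w , refl , inc) i with Lb⋖ᵍL⇒anchor i
  ... | A , refl , att = anchor⋖ᵍattached A (to-vertex att inc)
  ⋖ᵍ-incident⁺ {e = inj₂ e} (inj₁ y) _ i = ⊥-elim (¬L⋖ᵍLb i)
  ⋖ᵍ-incident⁺ {e = inj₂ e} (inj₂ y) (w , refl , inc) i with boundary? w
  ... | no _ = ⋖Lb⇒⋖ᵍ (Equivalence.to (FLb.⋖-incident inc) (⋖ᵍ⇒⋖Lb i))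
  ... | yes (d , refl) with FLb.⋖⇒edge (⋖ᵍ⇒⋖Lb i)
  ...   | q , refl with anchor-of (Equivalence.to (FLb.⋖-incident inc) (⋖ᵍ⇒⋖Lb i))
  ...     | A , refl = anchor⋖ᵍattached A (interface d)

  ⋖ᵍ-incident⁻ : ∀ {v e} z → Incidentᵍ v e → z ⋖ᵍ vertexᵍ v → z ⋖ᵍ edgeᵍ e
  ⋖ᵍ-incident⁻ {e = inj₁ e} (inj₁ y) (w , refl , inc) i = ⋖L⇒⋖ᵍ (Equivalence.from (FL.⋖-incident inc) (⋖ᵍ⇒⋖L i))
  ⋖ᵍ-incident⁻ {e = inj₁ e} (inj₂ y) (w , refl , inc) i with Lb⋖ᵍL⇒anchor i
  ... | A , refl , att = anchor⋖ᵍattached A (to-edge att inc)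
  ⋖ᵍ-incident⁻ {e = inj₂ e} z (w , refl , inc) i with boundary? w
  ⋖ᵍ-incident⁻ {e = inj₂ e} (inj₁ y) (w , refl , inc) i | no _ = ⊥-elim (¬L⋖ᵍLb i)
  ⋖ᵍ-incident⁻ {e = inj₂ e} (inj₂ y) (w , refl , inc) i | no _ = ⋖Lb⇒⋖ᵍ (Equivalence.from (FLb.⋖-incident inc) (⋖ᵍ⇒⋖Lb i))
  ⋖ᵍ-incident⁻ {e = inj₂ e} (inj₁ y) (w , refl , inc) i | yes (d , refl) = ⊥-elim (a-topLevel d y (proj₁ i))
  ⋖ᵍ-incident⁻ {e = inj₂ e} (inj₂ y) (w , refl , inc) i | yes (d , refl) with Lb⋖ᵍL⇒anchor i
  ... | A , refl , _ = ⋖Lb⇒⋖ᵍ (Equivalence.from (FLb.⋖-incident inc) (parent-imm A d))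

  ⌣ᵍ-par : ∀ z w → z ⌣ᵍ w → Σ (L.E ⊎ Lb.E) λ p → Hierarchicalᵍ p × edgeᵍ p ⋖ᵍ z × edgeᵍ p ⋖ᵍ w
  ⌣ᵍ-par (inj₁ x) (inj₁ y) (inj₁ s) with EL.⌣-par x y s
  ... | p , h , p⋖x , p⋖y = inj₁ p , h , ⋖L⇒⋖ᵍ p⋖x , ⋖L⇒⋖ᵍ p⋖y
  ⌣ᵍ-par (inj₁ x) (inj₁ y) (inj₂ (A , att-x , att-y)) =
    inj₂ (parent A) , anchor-hierarchical A (attached-source att-x) , anchor⋖ᵍattached A att-x , anchor⋖ᵍattached A att-y
  ⌣ᵍ-par (inj₁ x) (inj₂ y) (att , d , s) with ELb.⌣-par y _ s
  ... | p , h , p⋖y , p⋖cd with anchor-of p⋖cd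
  ...   | A , refl = inj₂ p , h , anchor⋖ᵍattached A att , ⋖Lb⇒⋖ᵍ p⋖y
  ⌣ᵍ-par (inj₂ y) (inj₁ x) (att , d , s) with ELb.⌣-par y _ s
  ... | p , h , p⋖y , p⋖cd with anchor-of p⋖cd
  ...   | A , refl = inj₂ p , h , ⋖Lb⇒⋖ᵍ p⋖y , anchor⋖ᵍattached A att
  ⌣ᵍ-par (inj₂ x) (inj₂ y) s with ELb.⌣-par x y s
  ... | p , h , p⋖x , p⋖y = inj₂ p , h , ⋖Lb⇒⋖ᵍ p⋖x , ⋖Lb⇒⋖ᵍ p⋖y

  ⌣ᵍ-refl : ∀ p z → edgeᵍ p ⋖ᵍ z → z ⌣ᵍ z
  ⌣ᵍ-refl (inj₁ p) (inj₁ x) i = inj₁ (EL.⌣-refl p x (FL.immPred⇒hierarchical (⋖ᵍ⇒⋖L i)) (⋖ᵍ⇒⋖L i))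
  ⌣ᵍ-refl (inj₁ p) (inj₂ x) i = ⊥-elim (¬L⋖ᵍLb i)
  ⌣ᵍ-refl (inj₂ p) (inj₁ x) i with Lb⋖ᵍL⇒anchor i
  ... | A , _ , att = inj₂ (A , att , att)
  ⌣ᵍ-refl (inj₂ p) (inj₂ x) i = ELb.⌣-refl p x (FLb.immPred⇒hierarchical (⋖ᵍ⇒⋖Lb i)) (⋖ᵍ⇒⋖Lb i)

  ⌣ᵍ-sym : ∀ z w → z ⌣ᵍ w → w ⌣ᵍ z
  ⌣ᵍ-sym (inj₁ x) (inj₁ y) (inj₁ s)                  = inj₁ (EL.⌣-sym x y s)
  ⌣ᵍ-sym (inj₁ x) (inj₁ y) (inj₂ (A , att-x , att-y)) = inj₂ (A , att-y , att-x)
  ⌣ᵍ-sym (inj₁ x) (inj₂ y) s = s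
  ⌣ᵍ-sym (inj₂ y) (inj₁ x) s = s
  ⌣ᵍ-sym (inj₂ x) (inj₂ y) s = ELb.⌣-sym x y s

  ⌣ᵍ-trans : ∀ x y z → x ⌣ᵍ y → y ⌣ᵍ z → x ⌣ᵍ z
  ⌣ᵍ-trans (inj₁ x) (inj₁ y) (inj₁ z) (inj₁ s₁) (inj₁ s₂) = inj₁ (EL.⌣-trans x y z s₁ s₂)
  ⌣ᵍ-trans (inj₁ x) (inj₁ y) (inj₁ z) (inj₁ s₁) (inj₂ (_ , att-y , _)) = ⊥-elim (⌣-¬attached s₁ att-y)
  ⌣ᵍ-trans (inj₁ x) (inj₁ y) (inj₁ z) (inj₂ (_ , _ , att-y)) (inj₁ s₂) = ⊥-elim (⌣-¬attached (EL.⌣-sym y z s₂) att-y)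
  ⌣ᵍ-trans (inj₁ x) (inj₁ y) (inj₁ z) (inj₂ (A , att-x , _)) (inj₂ (_ , _ , att-z)) = inj₂ (A , att-x , att-z)
  ⌣ᵍ-trans (inj₁ x) (inj₁ y) (inj₂ z) (inj₁ s₁) (att-y , _) = ⊥-elim (⌣-¬attached s₁ att-y)
  ⌣ᵍ-trans (inj₁ x) (inj₁ y) (inj₂ z) (inj₂ (_ , att-x , _)) (_ , s₂) = att-x , s₂
  ⌣ᵍ-trans (inj₁ x) (inj₂ y) (inj₁ z) (att-x , d , s₁) (att-z , _) = inj₂ (⌣-boundary⇒anchor s₁ , att-x , att-z)
  ⌣ᵍ-trans (inj₁ x) (inj₂ y) (inj₂ z) (att-x , d , s₁) s₂ = att-x , d , ELb.⌣-trans z y _ (ELb.⌣-sym y z s₂) s₁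
  ⌣ᵍ-trans (inj₂ y) (inj₁ x) (inj₁ z) (att-x , _) (inj₁ s₂) = ⊥-elim (⌣-¬attached (EL.⌣-sym x z s₂) att-x)
  ⌣ᵍ-trans (inj₂ y) (inj₁ x) (inj₁ z) (_ , s₁) (inj₂ (_ , _ , att-z)) = att-z , s₁
  ⌣ᵍ-trans (inj₂ y) (inj₁ x) (inj₂ z) (_ , d , s₁) (_ , d' , s₂) =
    ELb.⌣-trans y _ z s₁ (ELb.⌣-trans _ _ z (⌣-boundary⇒boundary-⌣ s₁ d d') (ELb.⌣-sym z _ s₂))
  ⌣ᵍ-trans (inj₂ y) (inj₂ y') (inj₁ x) s₁ (att-x , d , s₂) = att-x , d , ELb.⌣-trans y y' _ s₁ s₂
  ⌣ᵍ-trans (inj₂ x) (inj₂ y) (inj₂ z) s₁ s₂ = ELb.⌣-trans x y z s₁ s₂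

  ⌣ᵍ-conn : ∀ {v e} z → z ⋖ᵍ edgeᵍ e → z ⋖ᵍ vertexᵍ v → Incidentᵍ v e → edgeᵍ e ⌣ᵍ vertexᵍ v
  ⌣ᵍ-conn {e = inj₁ e} (inj₁ y) i₁ i₂ (w , refl , inc) with FL.⋖⇒edge (⋖ᵍ⇒⋖L i₁)
  ... | p , refl = inj₁ (EL.⌣-conn p e w (⋖ᵍ⇒⋖L i₁) (⋖ᵍ⇒⋖L i₂) inc)
  ⌣ᵍ-conn {e = inj₁ e} (inj₂ y) i₁ i₂ (w , refl , inc) with Lb⋖ᵍL⇒anchor i₁ | Lb⋖ᵍL⇒anchor i₂
  ... | A , _ , att-e | _ , _ , att-w = inj₂ (A , att-e , att-w)
  ⌣ᵍ-conn {e = inj₂ e} (inj₁ y) i₁ _ _ = ⊥-elim (¬L⋖ᵍLb i₁)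
  ⌣ᵍ-conn {e = inj₂ e} (inj₂ y) i₁ i₂ (w , refl , inc) with FLb.⋖⇒edge (⋖ᵍ⇒⋖Lb i₁) | boundary? w
  ... | q , refl | no _ = ELb.⌣-conn q e w (⋖ᵍ⇒⋖Lb i₁) (⋖ᵍ⇒⋖Lb i₂) inc
  ... | q , refl | yes (d , refl) =
    interface d , d , ELb.⌣-conn q e (c d) (⋖ᵍ⇒⋖Lb i₁) (Equivalence.to (FLb.⋖-incident inc) (⋖ᵍ⇒⋖Lb i₁)) inc

  nVᵍ nEᵍ : ℕ
  nVᵍ = L.nV + Lb.nV
  nEᵍ = L.nE + Lb.nE

  encV : L.V ⊎ Lb.V → Fin nVᵍ
  encV = join L.nV Lb.nV

  encE : L.E ⊎ Lb.E → Fin nEᵍ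
  encE = join L.nE Lb.nE

  srcᵍ tgtᵍ : L.E ⊎ Lb.E → List (L.V ⊎ Lb.V)
  srcᵍ = [ map inj₁ ∘ L.s , map glueV ∘ Lb.s ]
  tgtᵍ = [ map inj₁ ∘ L.t , map glueV ∘ Lb.t ]

  decode : Fin nVᵍ ⊎ Fin nEᵍ → Eltᵍ
  decode = [ vertexᵍ ∘ splitAt L.nV , edgeᵍ ∘ splitAt L.nE ]

  encode : Eltᵍ → Fin nVᵍ ⊎ Fin nEᵍ
  encode = [ map⊎ (encV ∘ inj₁) (encE ∘ inj₁) , map⊎ (encV ∘ inj₂) (encE ∘ inj₂) ]

  decode-encV : ∀ v → decode (inj₁ (encV v)) ≡ vertexᵍ v
  decode-encV v = cong vertexᵍ (splitAt-join L.nV Lb.nV v)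

  decode-encE : ∀ e → decode (inj₂ (encE e)) ≡ edgeᵍ e
  decode-encE e = cong edgeᵍ (splitAt-join L.nE Lb.nE e)

  decode-encode : ∀ z → decode (encode z) ≡ z
  decode-encode (inj₁ (inj₁ v)) = decode-encV (inj₁ v)
  decode-encode (inj₁ (inj₂ e)) = decode-encE (inj₁ e)
  decode-encode (inj₂ (inj₁ v)) = decode-encV (inj₂ v)
  decode-encode (inj₂ (inj₂ e)) = decode-encE (inj₂ e)

  encode-vertexᵍ : ∀ v → encode (vertexᵍ v) ≡ inj₁ (encV v)
  encode-vertexᵍ (inj₁ _) = refl
  encode-vertexᵍ (inj₂ _) = refl

  encode-edgeᵍ : ∀ e → encode (edgeᵍ e) ≡ inj₂ (encE e)
  encode-edgeᵍ (inj₁ _) = refl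
  encode-edgeᵍ (inj₂ _) = refl

  encode-decode : ∀ x → encode (decode x) ≡ x
  encode-decode (inj₁ v) = trans (encode-vertexᵍ (splitAt L.nV v)) (cong inj₁ (join-splitAt L.nV Lb.nV v))
  encode-decode (inj₂ e) = trans (encode-edgeᵍ (splitAt L.nE e)) (cong inj₂ (join-splitAt L.nE Lb.nE e))

  encV-injective : ∀ {v v'} → encV v ≡ encV v' → v ≡ v'
  encV-injective {v} {v'} eq =
    trans (sym (splitAt-join L.nV Lb.nV v)) (trans (cong (splitAt L.nV) eq) (splitAt-join L.nV Lb.nV v'))

  encE-injective : ∀ {e e'} → encE e ≡ encE e' → e ≡ e'
  encE-injective {e} {e'} eq =
    trans (sym (splitAt-join L.nE Lb.nE e)) (trans (cong (splitAt L.nE) eq) (splitAt-join L.nE Lb.nE e'))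

  Hᵖ : PreEHyp Sg
  Hᵖ = record
    { nV = nVᵍ ; nE = nEᵍ
    ; s = map encV ∘ srcᵍ ∘ splitAt L.nE
    ; t = map encV ∘ tgtᵍ ∘ splitAt L.nE
    ; l = labᵍ ∘ splitAt L.nE
    ; _<_ = λ x y → decode x <ᵍ decode y
    ; _⌣_ = λ x y → decode x ⌣ᵍ decode y
    }

  module Hᵖ = PreNotions Hᵖ

  immPredᴴ⇒⋖ᵍ : ∀ e x → Hᵖ.ImmPred e x → decode (inj₂ e) ⋖ᵍ decode x
  immPredᴴ⇒⋖ᵍ e x (e<x , imm) = e<x , λ z →
    imm (encode z) ∘ subst (λ w → (decode (inj₂ e) <ᵍ w) × (w <ᵍ decode x)) (sym (decode-encode z))

  ⋖ᵍ⇒immPredᴴ : ∀ e x → decode (inj₂ e) ⋖ᵍ decode x → Hᵖ.ImmPred e x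
  ⋖ᵍ⇒immPredᴴ e x (e<x , imm) = e<x , λ y → imm (decode y)

  incidentᴴ⇒Incidentᵍ : ∀ {v e} → Hᵖ.Incident v e → Incidentᵍ (splitAt L.nV v) (splitAt L.nE e)
  incidentᴴ⇒Incidentᵍ {v} {e} = go (splitAt L.nE e)
    where
    decodeV-∈ : ∀ {vs} → v ∈ map encV vs → Σ _ λ v' → (v' ∈ vs) × (splitAt L.nV v ≡ v')
    decodeV-∈ v∈ with ∈-map⁻ encV v∈
    ... | v' , v'∈ , refl = v' , v'∈ , splitAt-join L.nV Lb.nV v'
    lift : ∀ {A : Set} {f : A → L.V ⊎ Lb.V} {ws} → v ∈ map encV (map f ws) → Σ A λ w → (splitAt L.nV v ≡ f w) × (w ∈ ws)
    lift v∈ with decodeV-∈ v∈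
    ... | v' , v'∈ , eq with ∈-map⁻ _ v'∈
    ...   | w , w∈ , refl = w , eq , w∈
    go : ∀ e' → (v ∈ map encV (srcᵍ e')) ⊎ (v ∈ map encV (tgtᵍ e')) → Incidentᵍ (splitAt L.nV v) e'
    go (inj₁ e') (inj₁ v∈) = let w , eq , w∈ = lift v∈ in w , eq , inj₁ w∈
    go (inj₁ e') (inj₂ v∈) = let w , eq , w∈ = lift v∈ in w , eq , inj₂ w∈
    go (inj₂ e') (inj₁ v∈) = let w , eq , w∈ = lift v∈ in w , eq , inj₁ w∈
    go (inj₂ e') (inj₂ v∈) = let w , eq , w∈ = lift v∈ in w , eq , inj₂ w∈

  arityᵍ : ∀ e σ → labᵍ e ≡ just σ →
    (length (map encV (srcᵍ e)) ≡ Signature.ar Sg σ) × (length (map encV (tgtᵍ e)) ≡ Signature.coar Sg σ)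
  arityᵍ e σ eq = trans (length-src e) (proj₁ (arity e σ eq)) , trans (length-tgt e) (proj₂ (arity e σ eq))
    where
    arity : ∀ e σ → labᵍ e ≡ just σ →
      ([ length ∘ L.s , length ∘ Lb.s ] e ≡ Signature.ar Sg σ) × ([ length ∘ L.t , length ∘ Lb.t ] e ≡ Signature.coar Sg σ)
    arity (inj₁ e) = EL.arity e
    arity (inj₂ e) = ELb.arity e
    length-src : ∀ e → length (map encV (srcᵍ e)) ≡ [ length ∘ L.s , length ∘ Lb.s ] e
    length-src (inj₁ e) = trans (length-map encV (srcᵍ (inj₁ e))) (length-map inj₁ (L.s e))
    length-src (inj₂ e) = trans (length-map encV (srcᵍ (inj₂ e))) (length-map glueV (Lb.s e))
    length-tgt : ∀ e → length (map encV (tgtᵍ e)) ≡ [ length ∘ L.t , length ∘ Lb.t ] e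
    length-tgt (inj₁ e) = trans (length-map encV (tgtᵍ (inj₁ e))) (length-map inj₁ (L.t e))
    length-tgt (inj₂ e) = trans (length-map encV (tgtᵍ (inj₂ e))) (length-map glueV (Lb.t e))

  decode-injective : ∀ {x y} → decode x ≡ decode y → x ≡ y
  decode-injective {x} {y} eq = trans (sym (encode-decode x)) (trans (cong encode eq) (encode-decode y))

  s-encE : ∀ e → Hᵖ.s (encE e) ≡ map encV (srcᵍ e)
  s-encE e = cong (map encV ∘ srcᵍ) (splitAt-join L.nE Lb.nE e)

  t-encE : ∀ e → Hᵖ.t (encE e) ≡ map encV (tgtᵍ e)
  t-encE e = cong (map encV ∘ tgtᵍ) (splitAt-join L.nE Lb.nE e)

  l-encE : ∀ e → Hᵖ.l (encE e) ≡ labᵍ e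
  l-encE e = cong labᵍ (splitAt-join L.nE Lb.nE e)

  leafᵍ : ∀ e → (∀ z → ¬ (edgeᵍ e <ᵍ z)) → ¬ Hierarchicalᵍ e
  leafᵍ (inj₁ e) leaf = EL.leaf-lab e (leaf ∘ inj₁)
  leafᵍ (inj₂ e) leaf = ELb.leaf-lab e (leaf ∘ inj₂)

  H : EHyp Sg
  H = record
    { pre = Hᵖ
    ; arity = arityᵍ ∘ splitAt L.nE
    ; <-irrefl = <ᵍ-irrefl ∘ decode
    ; <-trans = λ x y z → <ᵍ-trans (decode x) (decode y) (decode z)
    ; pred-hier = λ y x y<x → let e , y≡e , h = <ᵍ-pred-hier (decode y) (decode x) y<x in
        encE e , trans (sym (encode-decode y)) (trans (cong encode y≡e) (encode-edgeᵍ e)) , trans (l-encE e) h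
    ; imm-uniq = λ e e' x i i' →
        inj₂-injective (decode-injective (⋖ᵍ-unique _ _ _ (immPredᴴ⇒⋖ᵍ e x i) (immPredᴴ⇒⋖ᵍ e' x i')))
    ; leaf-lab = λ e leaf → leafᵍ (splitAt L.nE e) λ z →
        leaf (encode z) ∘ subst (decode (inj₂ e) <ᵍ_) (sym (decode-encode z))
    ; inc-imm = λ e v inc p → mk⇔
        (⋖ᵍ⇒immPredᴴ p (inj₁ v) ∘ ⋖ᵍ-incident⁺ (decode (inj₂ p)) (incidentᴴ⇒Incidentᵍ inc) ∘ immPredᴴ⇒⋖ᵍ p (inj₂ e))
        (⋖ᵍ⇒immPredᴴ p (inj₂ e) ∘ ⋖ᵍ-incident⁻ (decode (inj₂ p)) (incidentᴴ⇒Incidentᵍ inc) ∘ immPredᴴ⇒⋖ᵍ p (inj₁ v))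
    ; ⌣-par = λ x y s → let p , h , p⋖x , p⋖y = ⌣ᵍ-par (decode x) (decode y) s in
        encE p , trans (l-encE p) h ,
        ⋖ᵍ⇒immPredᴴ (encE p) x (subst (_⋖ᵍ decode x) (sym (decode-encE p)) p⋖x) ,
        ⋖ᵍ⇒immPredᴴ (encE p) y (subst (_⋖ᵍ decode y) (sym (decode-encE p)) p⋖y)
    ; ⌣-refl = λ p x _ → ⌣ᵍ-refl (splitAt L.nE p) (decode x) ∘ immPredᴴ⇒⋖ᵍ p x
    ; ⌣-sym = λ x y → ⌣ᵍ-sym (decode x) (decode y)
    ; ⌣-trans = λ x y z → ⌣ᵍ-trans (decode x) (decode y) (decode z)
    ; ⌣-conn = λ p e v p⋖e p⋖v inc → ⌣ᵍ-conn (decode (inj₂ p))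
        (immPredᴴ⇒⋖ᵍ p (inj₂ e) p⋖e) (immPredᴴ⇒⋖ᵍ p (inj₁ v) p⋖v) (incidentᴴ⇒Incidentᵍ inc)
    }

  module H = Notions H

  decode-ι₁ : ∀ x → decode (map⊎ (encV ∘ inj₁) (encE ∘ inj₁) x) ≡ inj₁ x
  decode-ι₁ (inj₁ v) = decode-encV (inj₁ v)
  decode-ι₁ (inj₂ e) = decode-encE (inj₁ e)

  ι₁ : Hom L H
  ι₁ = record
    { fV = encV ∘ inj₁ ; fE = encE ∘ inj₁
    ; pres-s = λ e → trans (map-∘ (L.s e)) (sym (s-encE (inj₁ e)))
    ; pres-t = λ e → trans (map-∘ (L.t e)) (sym (t-encE (inj₁ e)))
    ; pres-l = λ e → l-encE (inj₁ e)
    ; pres-imm = λ e x i → ⋖ᵍ⇒immPredᴴ _ (map⊎ (encV ∘ inj₁) (encE ∘ inj₁) x)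
        (subst₂ _⋖ᵍ_ (sym (decode-encE (inj₁ e))) (sym (decode-ι₁ x)) (⋖L⇒⋖ᵍ i))
    ; pres-⌣ = λ x y s → subst₂ _⌣ᵍ_ (sym (decode-ι₁ x)) (sym (decode-ι₁ y)) (inj₁ s)
    }

  glueElt : Lb.Elt → Eltᵍ
  glueElt = [ vertexᵍ ∘ glueV , inj₂ ∘ inj₂ ]

  ⋖Lb⇒⋖ᵍglue : ∀ p x → Lb.ImmPred p x → inj₂ (inj₂ p) ⋖ᵍ glueElt x
  ⋖Lb⇒⋖ᵍglue p (inj₂ e) i = ⋖Lb⇒⋖ᵍ i
  ⋖Lb⇒⋖ᵍglue p (inj₁ v) i with boundary? v
  ... | no _ = ⋖Lb⇒⋖ᵍ i
  ... | yes (d , refl) with anchor-of i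
  ...   | A , refl = anchor⋖ᵍattached A (interface d)

  ⌣Lb⇒⌣ᵍglue : ∀ x y → x Lb.⌣ y → glueElt x ⌣ᵍ glueElt y
  ⌣Lb⇒⌣ᵍglue (inj₁ v) (inj₁ w) s with boundary? v | boundary? w
  ... | no _           | no _            = s
  ... | yes (d , refl) | no _            = interface d , d , ELb.⌣-sym _ _ s
  ... | no _           | yes (d , refl)  = interface d , d , s
  ... | yes (d , refl) | yes (d' , refl) = inj₂ (⌣-boundary⇒anchor s , interface d , interface d')
  ⌣Lb⇒⌣ᵍglue (inj₁ v) (inj₂ e) s with boundary? v
  ... | no _           = s
  ... | yes (d , refl) = interface d , d , ELb.⌣-sym _ _ s
  ⌣Lb⇒⌣ᵍglue (inj₂ e) (inj₁ w) s with boundary? w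
  ... | no _           = s
  ... | yes (d , refl) = interface d , d , s
  ⌣Lb⇒⌣ᵍglue (inj₂ e) (inj₂ e') s = s

  ⋖ᵍglue⇒⋖Lb : ∀ p x → inj₂ (inj₂ p) ⋖ᵍ glueElt x → Lb.ImmPred p x
  ⋖ᵍglue⇒⋖Lb p (inj₂ e) i = ⋖ᵍ⇒⋖Lb i
  ⋖ᵍglue⇒⋖Lb p (inj₁ v) i with boundary? v
  ... | no _ = ⋖ᵍ⇒⋖Lb i
  ... | yes (d , refl) with Lb⋖ᵍL⇒anchor i
  ...   | A , refl , _ = parent-imm A d

  ⌣ᵍ-boundary : ∀ d y → inj₁ (inj₁ (a d)) ⌣ᵍ inj₂ y → inj₁ (c d) Lb.⌣ y
  ⌣ᵍ-boundary d y (_ , d' , s) = ELb.⌣-trans _ _ _ (⌣-boundary⇒boundary-⌣ s d d') (ELb.⌣-sym _ _ s)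

  ⌣ᵍglue⇒⌣Lb : ∀ x y → glueElt x ⌣ᵍ glueElt y → x Lb.⌣ y
  ⌣ᵍglue⇒⌣Lb (inj₁ v) (inj₁ w) s with boundary? v | boundary? w
  ... | no _           | no _            = s
  ... | yes (d , refl) | no _            = ⌣ᵍ-boundary d _ s
  ... | no _           | yes (d , refl)  = ELb.⌣-sym _ _ (⌣ᵍ-boundary d _ s)
  ... | yes (d , refl) | yes (d' , refl) with s
  ...   | inj₁ a⌣a'     = ⊥-elim (⌣-¬attached a⌣a' (interface d'))
  ...   | inj₂ (A , _)  = boundary-⌣ (parent-imm A d) d d'
  ⌣ᵍglue⇒⌣Lb (inj₁ v) (inj₂ e) s with boundary? v
  ... | no _           = s
  ... | yes (d , refl) = ⌣ᵍ-boundary d _ s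
  ⌣ᵍglue⇒⌣Lb (inj₂ e) (inj₁ w) s with boundary? w
  ... | no _           = s
  ... | yes (d , refl) = ELb.⌣-sym _ _ (⌣ᵍ-boundary d _ s)
  ⌣ᵍglue⇒⌣Lb (inj₂ e) (inj₂ e') s = s

  decode-ι₂ : ∀ x → decode (map⊎ (encV ∘ glueV) (encE ∘ inj₂) x) ≡ glueElt x
  decode-ι₂ (inj₁ v) = decode-encV (glueV v)
  decode-ι₂ (inj₂ e) = decode-encE (inj₂ e)

  ι₂ : Hom Lb H
  ι₂ = record
    { fV = encV ∘ glueV ; fE = encE ∘ inj₂
    ; pres-s = λ e → trans (map-∘ (Lb.s e)) (sym (s-encE (inj₂ e)))
    ; pres-t = λ e → trans (map-∘ (Lb.t e)) (sym (t-encE (inj₂ e)))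
    ; pres-l = λ e → l-encE (inj₂ e)
    ; pres-imm = λ e x i → ⋖ᵍ⇒immPredᴴ _ (map⊎ (encV ∘ glueV) (encE ∘ inj₂) x)
        (subst₂ _⋖ᵍ_ (sym (decode-encE (inj₂ e))) (sym (decode-ι₂ x)) (⋖Lb⇒⋖ᵍglue e x i))
    ; pres-⌣ = λ x y s → subst₂ _⌣ᵍ_ (sym (decode-ι₂ x)) (sym (decode-ι₂ y)) (⌣Lb⇒⌣ᵍglue x y s)
    }

  ι-commute : ∀ d → fV ι₁ (a d) ≡ fV ι₂ (c d)
  ι-commute d = cong encV (sym (glueV-c d))

  module Collapse {G : EHyp Sg} (m : Hom L G) (g : Hom Lb G) (commute : ∀ d → fV m (a d) ≡ fV g (c d)) where
    module G = Notions G
    module EG = EHyp G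
    module FG = EHypProperties G

    collapseV : L.V ⊎ Lb.V → G.V
    collapseV = [ fV m , fV g ]

    collapseE : L.E ⊎ Lb.E → G.E
    collapseE = [ fE m , fE g ]

    collapseᵍ : Eltᵍ → G.Elt
    collapseᵍ = [ fElt m , fElt g ]

    collapse-glueV : ∀ v → collapseV (glueV v) ≡ fV g v
    collapse-glueV v with boundary? v
    ... | no _           = refl
    ... | yes (d , refl) = commute d

    collapse-src : ∀ e → map collapseV (srcᵍ e) ≡ G.s (collapseE e)
    collapse-src (inj₁ e) = trans (sym (map-∘ (L.s e))) (pres-s m e)
    collapse-src (inj₂ e) = trans (sym (map-∘ (Lb.s e))) (trans (map-cong collapse-glueV (Lb.s e)) (pres-s g e))

    collapse-tgt : ∀ e → map collapseV (tgtᵍ e) ≡ G.t (collapseE e)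
    collapse-tgt (inj₁ e) = trans (sym (map-∘ (L.t e))) (pres-t m e)
    collapse-tgt (inj₂ e) = trans (sym (map-∘ (Lb.t e))) (trans (map-cong collapse-glueV (Lb.t e)) (pres-t g e))

    collapse-lab : ∀ e → G.l (collapseE e) ≡ labᵍ e
    collapse-lab (inj₁ e) = pres-l m e
    collapse-lab (inj₂ e) = pres-l g e

    attached-imm : (A : Anchor) → ∀ {x} → Attached x → G.ImmPred (fE g (parent A)) (fElt m x)
    attached-imm A (interface d) =
      subst (λ v → G.ImmPred (fE g (parent A)) (inj₁ v)) (sym (commute d)) (pres-imm g _ _ (parent-imm A d))
    attached-imm A (to-edge {w} {e} att inc) =
      Equivalence.from (EG.inc-imm (fE m e) (fV m w) (Hom-incident m inc) _) (attached-imm A att)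
    attached-imm A (to-vertex {w} {e} att inc) =
      Equivalence.to (EG.inc-imm (fE m e) (fV m w) (Hom-incident m inc) _) (attached-imm A att)

    attached-⌣ : (A : Anchor) → ∀ {x} → Attached x → Σ D λ d → fElt m x G.⌣ inj₁ (fV g (c d))
    attached-⌣ A (interface d) = d , subst (λ v → inj₁ v G.⌣ inj₁ (fV g (c d))) (sym (commute d))
      (EG.⌣-refl _ _ (FG.immPred⇒hierarchical P⋖cd) P⋖cd)
      where
      P⋖cd : G.ImmPred (fE g (parent A)) (inj₁ (fV g (c d)))
      P⋖cd = pres-imm g _ _ (parent-imm A d)
    attached-⌣ A (to-edge {w} {e} att inc) with attached-⌣ A att
    ... | d , s = d , EG.⌣-trans _ _ _
      (EG.⌣-conn _ (fE m e) (fV m w) (attached-imm A (to-edge att inc)) (attached-imm A att) (Hom-incident m inc)) s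
    attached-⌣ A (to-vertex {w} {e} att inc) with attached-⌣ A att
    ... | d , s = d , EG.⌣-trans _ _ _ (EG.⌣-sym _ _
      (EG.⌣-conn _ (fE m e) (fV m w) (attached-imm A att) (attached-imm A (to-vertex att inc)) (Hom-incident m inc))) s

    collapse-⋖ : ∀ z w → z ⋖ᵍ w → collapseᵍ z FG.⋖ collapseᵍ w
    collapse-⋖ (inj₁ y) (inj₁ x) i with FL.⋖⇒edge (⋖ᵍ⇒⋖L i)
    ... | e , refl = pres-imm m e x (⋖ᵍ⇒⋖L i)
    collapse-⋖ (inj₁ y) (inj₂ x) i = ⊥-elim (¬L⋖ᵍLb i)
    collapse-⋖ (inj₂ y) (inj₁ x) i with Lb⋖ᵍL⇒anchor i
    ... | A , refl , att = attached-imm A att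
    collapse-⋖ (inj₂ y) (inj₂ x) i with FLb.⋖⇒edge (⋖ᵍ⇒⋖Lb i)
    ... | e , refl = pres-imm g e x (⋖ᵍ⇒⋖Lb i)

    collapse-⌣L⌣Lb : ∀ x y → inj₁ x ⌣ᵍ inj₂ y → fElt m x G.⌣ fElt g y
    collapse-⌣L⌣Lb x y (att , d , s) with attached-⌣ (⌣-boundary⇒anchor s) att
    ... | d₁ , s₁ = EG.⌣-trans _ _ _ s₁
      (EG.⌣-trans _ _ _ (pres-⌣ g _ _ (⌣-boundary⇒boundary-⌣ s d₁ d)) (EG.⌣-sym _ _ (pres-⌣ g _ _ s)))

    collapse-⌣ : ∀ z w → z ⌣ᵍ w → collapseᵍ z G.⌣ collapseᵍ w
    collapse-⌣ (inj₁ x) (inj₁ y) (inj₁ s) = pres-⌣ m x y s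
    collapse-⌣ (inj₁ x) (inj₁ y) (inj₂ (A , att-x , att-y)) with attached-⌣ A att-x | attached-⌣ A att-y
    ... | d₁ , s₁ | d₂ , s₂ = EG.⌣-trans _ _ _ s₁
      (EG.⌣-trans _ _ _ (pres-⌣ g _ _ (boundary-⌣ (parent-imm A d₁) d₁ d₂)) (EG.⌣-sym _ _ s₂))
    collapse-⌣ (inj₁ x) (inj₂ y) s = collapse-⌣L⌣Lb x y s
    collapse-⌣ (inj₂ y) (inj₁ x) s = EG.⌣-sym _ _ (collapse-⌣L⌣Lb x y s)
    collapse-⌣ (inj₂ x) (inj₂ y) s = pres-⌣ g x y s

    collapse-decode : ∀ x → map⊎ (collapseV ∘ splitAt L.nV) (collapseE ∘ splitAt L.nE) x ≡ collapseᵍ (decode x)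
    collapse-decode (inj₁ v) with splitAt L.nV v
    ... | inj₁ _ = refl
    ... | inj₂ _ = refl
    collapse-decode (inj₂ e) with splitAt L.nE e
    ... | inj₁ _ = refl
    ... | inj₂ _ = refl

    collapse : Hom H G
    collapse = record
      { fV = collapseV ∘ splitAt L.nV ; fE = collapseE ∘ splitAt L.nE
      ; pres-s = λ e → trans (sym (map-∘ (srcᵍ (splitAt L.nE e))))
          (trans (map-cong (cong collapseV ∘ splitAt-join L.nV Lb.nV) _) (collapse-src (splitAt L.nE e)))
      ; pres-t = λ e → trans (sym (map-∘ (tgtᵍ (splitAt L.nE e))))
          (trans (map-cong (cong collapseV ∘ splitAt-join L.nV Lb.nV) _) (collapse-tgt (splitAt L.nE e)))
      ; pres-l = collapse-lab ∘ splitAt L.nE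
      ; pres-imm = λ e x i → subst₂ FG._⋖_ (sym (collapse-decode (inj₂ e))) (sym (collapse-decode x))
          (collapse-⋖ (decode (inj₂ e)) (decode x) (immPredᴴ⇒⋖ᵍ e x i))
      ; pres-⌣ = λ x y s → subst₂ G._⌣_ (sym (collapse-decode x)) (sym (collapse-decode y))
          (collapse-⌣ (decode x) (decode y) s)
      }

  module PushoutConsequences {G : EHyp Sg} (m : Hom L G) (g : Hom Lb G) (po : IsPushout a c m g) where
    open Collapse m g (proj₁ po)

    toGluing : Hom G H
    toGluing = proj₁ (proj₂ po H ι₁ ι₂ ι-commute)

    toGluing-m : Agree m toGluing ι₁
    toGluing-m = proj₁ (proj₂ (proj₂ po H ι₁ ι₂ ι-commute))

    toGluing-g : Agree g toGluing ι₂
    toGluing-g = proj₁ (proj₂ (proj₂ (proj₂ po H ι₁ ι₂ ι-commute)))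

    endo-identity : (h : Hom G G) → Agree m h m → Agree g h g → HomEq h (idHom G)
    endo-identity h h-m h-g with proj₂ po G m g (proj₁ po)
    ... | _ , _ , _ , unique =
      (λ v → trans (sym (proj₁ (unique h h-m h-g) v)) (proj₁ (unique (idHom G) id-m id-g) v)) ,
      (λ e → trans (sym (proj₂ (unique h h-m h-g) e)) (proj₂ (unique (idHom G) id-m id-g) e))
      where
      id-m : Agree m (idHom G) m
      id-m = (λ _ → refl) , (λ _ → refl)
      id-g : Agree g (idHom G) g
      id-g = (λ _ → refl) , (λ _ → refl)

    collapse∘toGluing-m : Agree m (toGluing ⨾ collapse) m
    collapse∘toGluing-m =
      (λ v → trans (cong (fV collapse) (proj₁ toGluing-m v)) (cong collapseV (splitAt-join L.nV Lb.nV (inj₁ v)))) ,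
      (λ e → trans (cong (fE collapse) (proj₂ toGluing-m e)) (cong collapseE (splitAt-join L.nE Lb.nE (inj₁ e))))

    collapse∘toGluing-g : Agree g (toGluing ⨾ collapse) g
    collapse∘toGluing-g =
      (λ v → trans (cong (fV collapse) (proj₁ toGluing-g v))
               (trans (cong collapseV (splitAt-join L.nV Lb.nV (glueV v))) (collapse-glueV v))) ,
      (λ e → trans (cong (fE collapse) (proj₂ toGluing-g e)) (cong collapseE (splitAt-join L.nE Lb.nE (inj₂ e))))

    collapse∘toGluing≡id : HomEq (toGluing ⨾ collapse) (idHom G)
    collapse∘toGluing≡id = endo-identity (toGluing ⨾ collapse) collapse∘toGluing-m collapse∘toGluing-g

    jointly-surjectiveV : ∀ v → (Σ L.V λ w → fV m w ≡ v) ⊎ (Σ Lb.V λ x → fV g x ≡ v)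
    jointly-surjectiveV v with splitAt L.nV (fV toGluing v) | proj₁ collapse∘toGluing≡id v
    ... | inj₁ w | eq = inj₁ (w , eq)
    ... | inj₂ x | eq = inj₂ (x , eq)

    jointly-surjectiveE : ∀ e → (Σ L.E λ w → fE m w ≡ e) ⊎ (Σ Lb.E λ x → fE g x ≡ e)
    jointly-surjectiveE e with splitAt L.nE (fE toGluing e) | proj₂ collapse∘toGluing≡id e
    ... | inj₁ w | eq = inj₁ (w , eq)
    ... | inj₂ x | eq = inj₂ (x , eq)

    g-reflects-glueV : ∀ x y → fV g x ≡ fV g y → glueV x ≡ glueV y
    g-reflects-glueV x y eq = encV-injective
      (trans (sym (proj₁ toGluing-g x)) (trans (cong (fV toGluing) eq) (proj₁ toGluing-g y)))

    g≡m⇒glueV : ∀ x w → fV g x ≡ fV m w → glueV x ≡ inj₁ w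
    g≡m⇒glueV x w eq = encV-injective
      (trans (sym (proj₁ toGluing-g x)) (trans (cong (fV toGluing) eq) (proj₁ toGluing-m w)))

    g-injectiveE : ∀ e e' → fE g e ≡ fE g e' → e ≡ e'
    g-injectiveE e e' eq =
      inj₂-injective (encE-injective
        (trans (sym (proj₂ toGluing-g e)) (trans (cong (fE toGluing) eq) (proj₂ toGluing-g e'))))

    g≢mE : ∀ e w → fE g e ≢ fE m w
    g≢mE e w eq with encE-injective {inj₂ e} {inj₁ w}
      (trans (sym (proj₂ toGluing-g e)) (trans (cong (fE toGluing) eq) (proj₂ toGluing-m w)))
    ... | ()

    toGluing-ι₂ : ∀ x → fElt toGluing (fElt g x) ≡ fElt ι₂ x
    toGluing-ι₂ (inj₁ v) = cong inj₁ (proj₁ toGluing-g v)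
    toGluing-ι₂ (inj₂ e) = cong inj₂ (proj₂ toGluing-g e)

    g-reflects-imm : ∀ p x → G.ImmPred (fE g p) (fElt g x) → Lb.ImmPred p x
    g-reflects-imm p x i = ⋖ᵍglue⇒⋖Lb p x (subst₂ _⋖ᵍ_ (decode-encE (inj₂ p)) (decode-ι₂ x)
      (immPredᴴ⇒⋖ᵍ _ (fElt ι₂ x) (subst₂ H.ImmPred (proj₂ toGluing-g p) (toGluing-ι₂ x) (pres-imm toGluing _ _ i))))

    g-reflects-⌣ : ∀ x y → fElt g x G.⌣ fElt g y → x Lb.⌣ y
    g-reflects-⌣ x y s = ⌣ᵍglue⇒⌣Lb x y (subst₂ _⌣ᵍ_ (decode-ι₂ x) (decode-ι₂ y)
      (subst₂ H._⌣_ {x = fElt toGluing (fElt g x)} {u = fElt toGluing (fElt g y)}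
        (toGluing-ι₂ x) (toGluing-ι₂ y) (pres-⌣ toGluing _ _ s)))

    g-injectiveOn : (P : D → Set) → (∀ d d' → P d → P d' → a d ≡ a d' → d ≡ d') →
      ∀ y y' → GluedOnlyFrom P y → GluedOnlyFrom P y' → fV g y ≡ fV g y' → y ≡ y'
    g-injectiveOn P a-injective y y' Py Py' eq with boundary? y | boundary? y' | g-reflects-glueV y y' eq
    ... | no _           | no _            | eq' = inj₂-injective eq'
    ... | yes (d , refl) | yes (d' , refl) | eq' =
      cong c (a-injective d d' (Py d refl) (Py' d' refl) (inj₁-injective eq'))
    ... | yes _          | no _            | ()
    ... | no _           | yes _           | ()

    g-injective-interior : ∀ {y y'} → ¬ Boundary y → ¬ Boundary y' → fV g y ≡ fV g y' → y ≡ y'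
    g-injective-interior ¬b ¬b' =
      g-injectiveOn (λ _ → ⊥) (λ _ _ ()) _ _ (λ d eq → ¬b (d , eq)) (λ d eq → ¬b' (d , eq))

    g-interior≢m : ∀ {x} → ¬ Boundary x → ∀ w → fV g x ≢ fV m w
    g-interior≢m {x} ¬b w eq with trans (sym (glueV-interior ¬b)) (g≡m⇒glueV x w eq)
    ... | ()

module Uniqueness {Sg : Signature} {L G : EHyp Sg} (CL : Cospan L) (CG : Cospan G) (m : Hom L G)
  (mdaL : Cospan.MDA CL) where

  module L = Notions L
  module G = Notions G
  module FG = EHypProperties G
  module CL = Cospan CL

  D : Set
  D = BC.D CL CG m

  a : D → L.V
  a = BC.a CL CG m

  a-topLevel : ∀ d → L.TopLevel (inj₁ (a d))
  a-topLevel = let (_ , _ , inputs-top , outputs-top , _) , _ = mdaL in [ inputs-top , outputs-top ]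

  IsInput IsOutput : D → Set
  IsInput  = [ (λ _ → ⊤) , (λ _ → ⊥) ]
  IsOutput = [ (λ _ → ⊥) , (λ _ → ⊤) ]

  a-injectiveOn-inputs : ∀ d d' → IsInput d → IsInput d' → a d ≡ a d' → d ≡ d'
  a-injectiveOn-inputs (inj₁ i) (inj₁ i') _ _ eq =
    let (inO-injective , _) , _ , inL-injective , _ = mdaL in cong inj₁ (inO-injective _ _ (inL-injective _ _ eq))
  a-injectiveOn-inputs (inj₂ _) _ ()
  a-injectiveOn-inputs (inj₁ _) (inj₂ _) _ ()

  a-injectiveOn-outputs : ∀ d d' → IsOutput d → IsOutput d' → a d ≡ a d' → d ≡ d'
  a-injectiveOn-outputs (inj₂ j) (inj₂ j') _ _ eq =
    let (_ , outO-injective , _) , _ , _ , outL-injective , _ = mdaL in cong inj₂ (outO-injective _ _ (outL-injective _ _ eq))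
  a-injectiveOn-outputs (inj₁ _) _ ()
  a-injectiveOn-outputs (inj₂ _) (inj₁ _) _ ()

  module Complement (B : BC.BoundaryComplement CL CG m) where
    open BC.BoundaryComplement B public
    module Lb = Notions Lb
    module FLb = EHypProperties Lb
    open Gluing L Lb a c c-mono a-topLevel bdLb public
      using (Boundary; boundary?; boundary-elim; GluedOnlyFrom)
    open Gluing.PushoutConsequences L Lb a c c-mono a-topLevel bdLb m g pushout public

    -- In Lb the images of L's inputs lie on the output interface of the
    -- complement and vice versa, so they have out-degree (in-degree) zero.
    complement-interface-degrees : ∀ {A B X Y : Set} {inO : A → X ⊎ Fin CL.no} {outO : B → Y ⊎ Fin CL.ni}
      {g₁ : X → Lb.V} {g₂ : Y → Lb.V} → IsMDA Lb inO [ g₁ , c ∘ inj₂ ] [ g₂ , c ∘ inj₁ ] outO →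
      (∀ j → Lb.inDeg (c (inj₂ j)) ≡ 0) × (∀ i → Lb.outDeg (c (inj₁ i)) ≡ 0)
    complement-interface-degrees mda =
      let inputs , outputs = mda-interface-degrees mda in inputs ∘ inj₂ , outputs ∘ inj₂

    glued-degrees : (∀ j → Lb.inDeg (c (inj₂ j)) ≡ 0) × (∀ i → Lb.outDeg (c (inj₁ i)) ≡ 0)
    glued-degrees with proj₂ bdG
    ... | inj₁ allTop = complement-interface-degrees (proj₁ (proj₂ (top allTop)))
    ... | inj₂ all⌣   = complement-interface-degrees (proj₂ (nontop λ d → FG.⌣⇒¬topLevel (all⌣ d d)))

    sources-glued-from-outputs : ∀ {y e} → y ∈ Lb.s e → GluedOnlyFrom IsOutput y
    sources-glued-from-outputs {e = e} y∈s (inj₁ i) refl = FLb.outDeg≡0⇒∉s (proj₂ glued-degrees i) e y∈s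
    sources-glued-from-outputs y∈s (inj₂ j) _ = tt

    targets-glued-from-inputs : ∀ {y e} → y ∈ Lb.t e → GluedOnlyFrom IsInput y
    targets-glued-from-inputs y∈t (inj₁ i) _ = tt
    targets-glued-from-inputs {e = e} y∈t (inj₂ j) refl = FLb.inDeg≡0⇒∉t (proj₁ glued-degrees j) e y∈t

  module Comparison (B B' : BC.BoundaryComplement CL CG m) where
    module P = Complement B
    module P' = Complement B'

    interior-preimage : ∀ x → ¬ P.Boundary x → Σ P'.Lb.V λ y → fV P'.g y ≡ fV P.g x
    interior-preimage x ¬b with P'.jointly-surjectiveV (fV P.g x)
    ... | inj₁ (w , eq) = ⊥-elim (P.g-interior≢m ¬b w (sym eq))
    ... | inj₂ (y , eq) = y , eq

    interior-preimage-interior : ∀ x (¬b : ¬ P.Boundary x) → ¬ P'.Boundary (proj₁ (interior-preimage x ¬b))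
    interior-preimage-interior x ¬b (d , eq) = P.g-interior≢m ¬b (a d) (begin
      fV P.g x                                  ≡⟨ proj₂ (interior-preimage x ¬b) ⟨
      fV P'.g (proj₁ (interior-preimage x ¬b))  ≡⟨ cong (fV P'.g) eq ⟨
      fV P'.g (P'.c d)                          ≡⟨ proj₁ P'.pushout d ⟨
      fV m (a d)                                ∎)

    φV : P.Lb.V → P'.Lb.V
    φV x with P.boundary? x
    ... | yes (d , _) = P'.c d
    ... | no ¬b       = proj₁ (interior-preimage x ¬b)

    φV-g : ∀ x → fV P'.g (φV x) ≡ fV P.g x
    φV-g x with P.boundary? x
    ... | yes (d , refl) = trans (sym (proj₁ P'.pushout d)) (proj₁ P.pushout d)
    ... | no ¬b          = proj₂ (interior-preimage x ¬b)

    φV-c : ∀ d → φV (P.c d) ≡ P'.c d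
    φV-c d with P.boundary? (P.c d)
    ... | yes (d' , eq) = cong P'.c (P.c-mono d' d eq)
    ... | no ¬b         = ⊥-elim (¬b (d , refl))

    φV-reflects-boundary : ∀ x d → P'.c d ≡ φV x → P.c d ≡ x
    φV-reflects-boundary x d eq with P.boundary? x
    ... | yes (d' , refl) = cong P.c (P'.c-mono d d' eq)
    ... | no ¬b           = ⊥-elim (interior-preimage-interior x ¬b (d , eq))

    φV-interior : ∀ {x} → ¬ P.Boundary x → ¬ P'.Boundary (φV x)
    φV-interior {x} ¬b (d , eq) = ¬b (d , φV-reflects-boundary x d eq)

    φV-gluedOnlyFrom : ∀ {Q x} → P.GluedOnlyFrom Q x → P'.GluedOnlyFrom Q (φV x)
    φV-gluedOnlyFrom {x = x} Qx d eq = Qx d (φV-reflects-boundary x d eq)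

    φE : P.Lb.E → P'.Lb.E
    φE e with P'.jointly-surjectiveE (fE P.g e)
    ... | inj₁ (w , eq) = ⊥-elim (P.g≢mE e w (sym eq))
    ... | inj₂ (y , _)  = y

    φE-g : ∀ e → fE P'.g (φE e) ≡ fE P.g e
    φE-g e with P'.jointly-surjectiveE (fE P.g e)
    ... | inj₁ (w , eq) = ⊥-elim (P.g≢mE e w (sym eq))
    ... | inj₂ (_ , eq) = eq

    φElt : P.Lb.Elt → P'.Lb.Elt
    φElt = map⊎ φV φE

    φElt-g : ∀ x → fElt P'.g (φElt x) ≡ fElt P.g x
    φElt-g (inj₁ v) = cong inj₁ (φV-g v)
    φElt-g (inj₂ e) = cong inj₂ (φE-g e)

    map-φV-determined : (Q : D → Set) → (∀ d d' → Q d → Q d' → a d ≡ a d' → d ≡ d') →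
      ∀ xs ys → All (P.GluedOnlyFrom Q) xs → All (P'.GluedOnlyFrom Q) ys →
      map (fV P.g) xs ≡ map (fV P'.g) ys → map φV xs ≡ ys
    map-φV-determined Q a-injective xs ys Qxs Qys eq =
      map-injectiveOn (fV P'.g) (P'.GluedOnlyFrom Q) (P'.g-injectiveOn Q a-injective)
        (map φV xs) ys (gmap⁺ φV-gluedOnlyFrom Qxs) Qys
        (trans (sym (map-∘ xs)) (trans (map-cong φV-g xs) eq))

    φ-pres-s : ∀ e → map φV (P.Lb.s e) ≡ P'.Lb.s (φE e)
    φ-pres-s e = map-φV-determined IsOutput a-injectiveOn-outputs _ _
      (tabulate P.sources-glued-from-outputs) (tabulate P'.sources-glued-from-outputs)
      (trans (pres-s P.g e) (trans (cong G.s (sym (φE-g e))) (sym (pres-s P'.g (φE e)))))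

    φ-pres-t : ∀ e → map φV (P.Lb.t e) ≡ P'.Lb.t (φE e)
    φ-pres-t e = map-φV-determined IsInput a-injectiveOn-inputs _ _
      (tabulate P.targets-glued-from-inputs) (tabulate P'.targets-glued-from-inputs)
      (trans (pres-t P.g e) (trans (cong G.t (sym (φE-g e))) (sym (pres-t P'.g (φE e)))))

    φ : Hom P.Lb P'.Lb
    φ = record
      { fV = φV ; fE = φE
      ; pres-s = φ-pres-s ; pres-t = φ-pres-t
      ; pres-l = λ e → trans (sym (pres-l P'.g (φE e))) (trans (cong G.l (φE-g e)) (pres-l P.g e))
      ; pres-imm = λ p x i → P'.g-reflects-imm (φE p) (φElt x)
          (subst₂ G.ImmPred (sym (φE-g p)) (sym (φElt-g x)) (pres-imm P.g p x i))
      ; pres-⌣ = λ x y s → P'.g-reflects-⌣ (φElt x) (φElt y)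
          (subst₂ G._⌣_ (sym (φElt-g x)) (sym (φElt-g y)) (pres-⌣ P.g x y s))
      }

  module RoundTrip (B B' : BC.BoundaryComplement CL CG m) where
    module P = Complement B
    module Φ = Comparison B B'
    module Ψ = Comparison B' B

    ψ∘φV≡id : ∀ x → Ψ.φV (Φ.φV x) ≡ x
    ψ∘φV≡id = P.boundary-elim (λ x → Ψ.φV (Φ.φV x) ≡ x)
      (λ d → trans (cong Ψ.φV (Φ.φV-c d)) (Ψ.φV-c d))
      (λ {x} ¬b → P.g-injective-interior (Ψ.φV-interior (Φ.φV-interior ¬b)) ¬b
        (trans (Ψ.φV-g (Φ.φV x)) (Φ.φV-g x)))

    ψ∘φE≡id : ∀ e → Ψ.φE (Φ.φE e) ≡ e
    ψ∘φE≡id e = P.g-injectiveE _ _ (trans (Ψ.φE-g (Φ.φE e)) (Φ.φE-g e))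

mainTheorem6 : ∀ {Sg : Signature} {L G : EHyp Sg} (CL : Cospan L) (CG : Cospan G) (m : Hom L G) →
    Cospan.MDA CL → Cospan.MDA CG → IsMono m →
    (B₁ B₂ : BC.BoundaryComplement CL CG m) → BC.Isomorphic CL CG m B₁ B₂
mainTheorem6 CL CG m mdaL _ _ B₁ B₂ =
  Φ.φ , Ψ.φ , Forth.ψ∘φV≡id , Forth.ψ∘φE≡id , Back.ψ∘φV≡id , Back.ψ∘φE≡id , Φ.φV-c , Φ.φV-g , Φ.φE-g
  where
  open Uniqueness CL CG m mdaL
  module Φ = Comparison B₁ B₂
  module Ψ = Comparison B₂ B₁
  module Forth = RoundTrip B₁ B₂
  module Back = RoundTrip B₂ B₁
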